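{- For every $n\le m\le\binom{n}{2}$, there exists a sequence of $m$ edge insertions for which the degree-biased incremental MIS algorithm requires total $\Theta(m\sqrt m)$ time to maintain the maximal independent set.
   Context: A maximal independent set (MIS) $\mathcal M$ is an independent set of vertices not properly contained in any other independent set. The degree-biased incremental MIS algorithm maintains an MIS $\mathcal M$ and, for every vertex, a count of its neighbours in $\mathcal M$; whenever a vertex $v$ enters or leaves $\mathcal M$, the counts of all its neighbours are updated in $O(\deg(v))$ time. On insertion of an edge $(u,v)$, nothing changes unless both $u,v\in\mathcal M$, in which case the endpoint of lower current degree is removed from $\mathcal M$, the counts of its neighbours are updated, and every neighbour whose count becomes zero is added to $\mathcal M$ (updating counts of its neighbours). -}

module Defs where

open import Data.Nat using (ℕ; zero; suc; _+_; _*_; _≤ᵇ_; _≡ᵇ_)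
open import Data.Fin using (Fin; _≟_)
open import Data.Bool using (Bool; true; false; _∧_; _∨_; not; if_then_else_)
open import Data.List using (List; []; _∷_; length; filterᵇ; allFin)
open import Data.Product using (_×_; _,_)
open import Data.Unit using (⊤)
open import Relation.Nullary using (does; ¬_)
open import Relation.Binary.PropositionalEquality using (_≡_; _≢_)

Edge : ℕ → Set
Edge n = Fin n × Fin n

Graph : ℕ → Set
Graph n = List (Edge n)

-- Membership in the maintained independent set M.
State : ℕ → Set
State n = Fin n → Bool

sameFin : ∀ {n} → Fin n → Fin n → Bool
sameFin x y = does (x ≟ y)

adj : ∀ {n} → Graph n → Fin n → Fin n → Bool
adj [] x y = false
adj ((a , b) ∷ E) x y =
  (sameFin a x ∧ sameFin b y) ∨ (sameFin a y ∧ sameFin b x) ∨ adj E x y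

-- neighbours of x, in increasing order of index
neighbours : ∀ {n} → Graph n → Fin n → List (Fin n)
neighbours {n} E x = filterᵇ (adj E x) (allFin n)

deg : ∀ {n} → Graph n → Fin n → ℕ
deg E x = length (neighbours E x)

mcount : ∀ {n} → Graph n → State n → Fin n → ℕ
mcount E M x = length (filterᵇ M (neighbours E x))

set : ∀ {n} → State n → Fin n → Bool → State n
set M w b y = if sameFin w y then b else M y

-- Process the neighbours of the removed vertex in order: each one not in M whose
-- count (w.r.t. the current M) is zero is added to M, costing deg(y) to update
-- the counts of its neighbours.
addFree : ∀ {n} → Graph n → State n → List (Fin n) → State n × ℕ
addFree E M [] = M , 0
addFree E M (y ∷ ys) =
  if not (M y) ∧ (mcount E M y ≡ᵇ 0)
  then addY (addFree E (set M y true) ys)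
  else addFree E M ys
  where
  addY : _ → _
  addY (M' , c) = M' , deg E y + c

-- Cost: 1 for the insertion itself; if both endpoints are in M, the endpoint w of
-- lower current degree leaves M (cost deg w to update counts of its neighbours),
-- then neighbours whose count becomes zero are added (cost deg of each).
insertStep : ∀ {n} → Graph n → State n → Edge n → Graph n × State n × ℕ
insertStep E M (u , v) = if M u ∧ M v then removal else (E' , M , 1)
  where
  E' = (u , v) ∷ E
  w = if deg E' v ≤ᵇ deg E' u then v else u
  removal : _
  removal with addFree E' (set M w false) (neighbours E' w)
  ... | (M2 , c) = E' , M2 , suc (deg E' w + c)

runCost : ∀ {n} → Graph n → State n → List (Edge n) → ℕ
runCost E M [] = 0
runCost E M (e ∷ es) with insertStep E M e
... | (E' , M' , c) = c + runCost E' M' es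

-- the algorithm starts from the empty graph on n vertices, whose MIS is all vertices
totalTime : ∀ {n} → List (Edge n) → ℕ
totalTime σ = runCost [] (λ _ → true) σ

ValidSeq : ∀ {n} → Graph n → List (Edge n) → Set
ValidSeq E [] = ⊤
ValidSeq E ((u , v) ∷ es) = u ≢ v × adj E u v ≡ false × ValidSeq ((u , v) ∷ E) es

-- A hub vertex k first receives d ≥ k pendant leaves, each insertion evicting the new leaf;
-- from then on the hub has the largest degree and never leaves the set.  Round r, for
-- r = 0, …, k−1, joins r to r+1, …, k−1, each insertion evicting the new neighbour, and then
-- joins r to the hub: r has degree k while the hub has degree at least d ≥ k, so r is evicted,
-- and its k−r−1 neighbours above it, whose only neighbour in the set was r, are readmitted,
-- each at the cost of its degree r+1.
-- The rounds use about k²/2 edges but cost Σᵣ (k−r−1)(r+1) = Θ(k³).  Edges into evicted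
-- leaves, costing 1 each, pad the sequence to m insertions.  With 4k² ≤ m < 4(k+1)² the
-- total time is Θ(k³ + m) = Θ(m √m).

module Submission where

open import Defs
open import Data.Nat using (ℕ; _≤_; _*_; _^_)
open import Data.Nat.Combinatorics using (_C_)
open import Data.List using (List; []; length)
open import Data.Product using (∃-syntax; _×_)
open import Relation.Binary.PropositionalEquality using (_≡_)

open import Data.Nat
open import Data.Nat.Properties
open import Data.Nat.Combinatorics using (nC1≡n; nCk+nC[k+1]≡[n+1]C[k+1])
open import Data.Nat.ListAction using (sum)
open import Data.Nat.Tactic.RingSolver using (solve-∀)
open import Data.Bool using (Bool; true; false; _∧_; _∨_; not; if_then_else_; T)
open import Data.Bool.Properties using (∨-identityʳ; ∨-zeroʳ; ∧-zeroʳ)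
open import Data.Fin using (Fin; toℕ) renaming (zero to fzero; suc to fsuc)
open import Data.Fin.Properties using (toℕ-injective; toℕ<n)
open import Data.List using (_∷_; filterᵇ; allFin; tabulate; _++_; map; take)
open import Data.List.Properties using (length-++; length-take; ++-assoc)
open import Data.List.Membership.Propositional using (_∈_; _∉_)
open import Data.List.Membership.Propositional.Properties using (∈-filter⁺; ∈-filter⁻; ∈-allFin)
open import Data.List.Relation.Unary.Any using (here; there)
open import Data.List.Relation.Unary.All using (All; []; _∷_)
import Data.List.Relation.Unary.All as All
import Data.List.Relation.Unary.All.Properties as All
open import Data.List.Relation.Unary.AllPairs using (_∷_)
open import Data.List.Relation.Unary.Unique.Propositional using (Unique)
import Data.List.Relation.Unary.Unique.Propositional.Properties as Unique
open import Data.Product using (Σ; _,_; proj₁; proj₂)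
open import Data.Sum using (_⊎_; inj₁; inj₂; map₁)
open import Data.Empty using (⊥; ⊥-elim)
open import Data.Unit using (tt)
open import Relation.Nullary using (¬_; yes; no)
open import Relation.Nullary.Decidable using (T?)
open import Relation.Binary.PropositionalEquality
open import Function using (_∘_; id)

false≢true : false ≢ true
false≢true ()

≢true⇒≡false : ∀ {a} → ¬ (a ≡ true) → a ≡ false
≢true⇒≡false {false} _ = refl
≢true⇒≡false {true} h = ⊥-elim (h refl)

≡-from-≡true : ∀ {a b : Bool} → (a ≡ true → b ≡ true) → (b ≡ true → a ≡ true) → a ≡ b
≡-from-≡true {false} {false} f g = refl
≡-from-≡true {false} {true} f g = g refl
≡-from-≡true {true} {false} f g = sym (f refl)
≡-from-≡true {true} {true} f g = refl

∨≡true⁻ : ∀ a b → a ∨ b ≡ true → a ≡ true ⊎ b ≡ true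
∨≡true⁻ true b _ = inj₁ refl
∨≡true⁻ false b e = inj₂ e

∨≡trueˡ : ∀ a b → a ≡ true → a ∨ b ≡ true
∨≡trueˡ true b _ = refl

∨≡trueʳ : ∀ a b → b ≡ true → a ∨ b ≡ true
∨≡trueʳ true b _ = refl
∨≡trueʳ false b e = e

∧≡true⁻ : ∀ a b → a ∧ b ≡ true → a ≡ true × b ≡ true
∧≡true⁻ true true _ = refl , refl

∧≡true⁺ : ∀ {a b} → a ≡ true → b ≡ true → a ∧ b ≡ true
∧≡true⁺ refl refl = refl

<ᵇ≡true⇒< : ∀ a b → (a <ᵇ b) ≡ true → a < b
<ᵇ≡true⇒< a b e = <ᵇ⇒< a b (subst T (sym e) tt)

<⇒<ᵇ≡true : ∀ {a b} → a < b → (a <ᵇ b) ≡ true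
<⇒<ᵇ≡true {a} {b} p with a <ᵇ b | <⇒<ᵇ p
... | true | _ = refl

<ᵇ≡false⇒≥ : ∀ a b → (a <ᵇ b) ≡ false → b ≤ a
<ᵇ≡false⇒≥ a b e = ≮⇒≥ (λ lt → false≢true (trans (sym e) (<⇒<ᵇ≡true lt)))

≤⇒≤ᵇ≡true : ∀ {a b} → a ≤ b → (a ≤ᵇ b) ≡ true
≤⇒≤ᵇ≡true {a} {b} p with a ≤ᵇ b | ≤⇒≤ᵇ p
... | true | _ = refl

≡ᵇ≡true⇒≡ : ∀ a b → (a ≡ᵇ b) ≡ true → a ≡ b
≡ᵇ≡true⇒≡ a b e = ≡ᵇ⇒≡ a b (subst T (sym e) tt)

≡ᵇ-refl : ∀ a → (a ≡ᵇ a) ≡ true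
≡ᵇ-refl zero = refl
≡ᵇ-refl (suc a) = ≡ᵇ-refl a

boolToℕ : Bool → ℕ
boolToℕ true = 1
boolToℕ false = 0

boolToℕ-mono : ∀ {a b} → (a ≡ true → b ≡ true) → boolToℕ a ≤ boolToℕ b
boolToℕ-mono {false} h = z≤n
boolToℕ-mono {true} h rewrite h refl = ≤-refl

-- Counting the indices below n that satisfy a Boolean predicate

countBelow : ℕ → (ℕ → Bool) → ℕ
countBelow zero q = 0
countBelow (suc n) q = countBelow n q + boolToℕ (q n)

countBelow-suc-shift : ∀ n q → countBelow (suc n) q ≡ boolToℕ (q 0) + countBelow n (q ∘ suc)
countBelow-suc-shift zero q = +-comm 0 (boolToℕ (q 0))
countBelow-suc-shift (suc n) q = begin
    countBelow (suc n) q + boolToℕ (q (suc n))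
  ≡⟨ cong (_+ boolToℕ (q (suc n))) (countBelow-suc-shift n q) ⟩
    boolToℕ (q 0) + countBelow n (q ∘ suc) + boolToℕ (q (suc n))
  ≡⟨ +-assoc (boolToℕ (q 0)) _ _ ⟩
    boolToℕ (q 0) + countBelow (suc n) (q ∘ suc) ∎
  where open ≡-Reasoning

countBelow-<ᵇ : ∀ n b → countBelow n (_<ᵇ b) ≡ n ⊓ b
countBelow-<ᵇ zero b = refl
countBelow-<ᵇ (suc n) b with n <ᵇ b in eq
... | true = begin
      countBelow n (_<ᵇ b) + 1    ≡⟨ cong (_+ 1) (countBelow-<ᵇ n b) ⟩
      n ⊓ b + 1                   ≡⟨ cong (_+ 1) (m≤n⇒m⊓n≡m (<⇒≤ n<b)) ⟩
      n + 1                       ≡⟨ +-comm n 1 ⟩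
      suc n                       ≡⟨ m≤n⇒m⊓n≡m n<b ⟨
      suc n ⊓ b                   ∎
  where open ≡-Reasoning
        n<b : n < b
        n<b = <ᵇ≡true⇒< n b eq
... | false = begin
      countBelow n (_<ᵇ b) + 0    ≡⟨ +-identityʳ _ ⟩
      countBelow n (_<ᵇ b)        ≡⟨ countBelow-<ᵇ n b ⟩
      n ⊓ b                       ≡⟨ m≥n⇒m⊓n≡n b≤n ⟩
      b                           ≡⟨ m≥n⇒m⊓n≡n (m≤n⇒m≤1+n b≤n) ⟨
      suc n ⊓ b                   ∎
  where open ≡-Reasoning
        b≤n : b ≤ n
        b≤n = <ᵇ≡false⇒≥ n b eq

countBelow-<ᵇ-≤ : ∀ {n b} → b ≤ n → countBelow n (_<ᵇ b) ≡ b
countBelow-<ᵇ-≤ {n} {b} b≤n = trans (countBelow-<ᵇ n b) (m≥n⇒m⊓n≡n b≤n)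

countBelow-+ : ∀ n q q₁ q₂ → (∀ y → boolToℕ (q y) ≡ boolToℕ (q₁ y) + boolToℕ (q₂ y)) →
  countBelow n q ≡ countBelow n q₁ + countBelow n q₂
countBelow-+ zero q q₁ q₂ h = refl
countBelow-+ (suc n) q q₁ q₂ h = trans
  (cong₂ _+_ (countBelow-+ n q q₁ q₂ h) (h n))
  (shuffle (countBelow n q₁) (countBelow n q₂) (boolToℕ (q₁ n)) (boolToℕ (q₂ n)))
  where
  shuffle : ∀ a b c d → (a + b) + (c + d) ≡ (a + c) + (b + d)
  shuffle = solve-∀

countBelow-∨ : ∀ n q₁ q₂ → (∀ y → q₁ y ≡ true → q₂ y ≡ true → ⊥) →
  countBelow n (λ y → q₁ y ∨ q₂ y) ≡ countBelow n q₁ + countBelow n q₂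
countBelow-∨ n q₁ q₂ disjoint = countBelow-+ n _ q₁ q₂ pointwise
  where
  pointwise : ∀ y → boolToℕ (q₁ y ∨ q₂ y) ≡ boolToℕ (q₁ y) + boolToℕ (q₂ y)
  pointwise y with q₁ y in e₁ | q₂ y in e₂
  ... | true | true = ⊥-elim (disjoint y e₁ e₂)
  ... | true | false = refl
  ... | false | true = refl
  ... | false | false = refl

between : ℕ → ℕ → ℕ → Bool
between a b y = (y <ᵇ b) ∧ not (y <ᵇ a)

between⁻ : ∀ a b y → between a b y ≡ true → a ≤ y × y < b
between⁻ a b y e with y <ᵇ b in e₁ | y <ᵇ a in e₂
between⁻ a b y refl | true | false = <ᵇ≡false⇒≥ y a e₂ , <ᵇ≡true⇒< y b e₁

between⁺ : ∀ {a b y} → a ≤ y → y < b → between a b y ≡ true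
between⁺ {a} {b} {y} a≤y y<b with y <ᵇ b in e₁ | y <ᵇ a in e₂
... | true | false = refl
... | true | true = ⊥-elim (<⇒≱ (<ᵇ≡true⇒< y a e₂) a≤y)
... | false | _ = ⊥-elim (false≢true (trans (sym e₁) (<⇒<ᵇ≡true y<b)))

countBelow-between : ∀ n a b → a ≤ b → b ≤ n → countBelow n (between a b) ≡ b ∸ a
countBelow-between n a b a≤b b≤n = begin
    countBelow n (between a b)
  ≡⟨ m+n∸m≡n (countBelow n (_<ᵇ a)) _ ⟨
    countBelow n (_<ᵇ a) + countBelow n (between a b) ∸ countBelow n (_<ᵇ a)
  ≡⟨ cong (_∸ countBelow n (_<ᵇ a)) (countBelow-+ n (_<ᵇ b) (_<ᵇ a) (between a b) pointwise) ⟨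
    countBelow n (_<ᵇ b) ∸ countBelow n (_<ᵇ a)
  ≡⟨ cong₂ _∸_ (countBelow-<ᵇ-≤ b≤n) (countBelow-<ᵇ-≤ (≤-trans a≤b b≤n)) ⟩
    b ∸ a ∎
  where
  open ≡-Reasoning
  pointwise : ∀ y → boolToℕ (y <ᵇ b) ≡ boolToℕ (y <ᵇ a) + boolToℕ (between a b y)
  pointwise y with y <ᵇ b in e₁ | y <ᵇ a in e₂
  ... | true | true = refl
  ... | true | false = refl
  ... | false | false = refl
  ... | false | true = ⊥-elim (false≢true (trans (sym e₁) (<⇒<ᵇ≡true (<-≤-trans (<ᵇ≡true⇒< y a e₂) a≤b))))

countBelow-singleton : ∀ {n} a → a < n → countBelow n (between a (suc a)) ≡ 1
countBelow-singleton {n} a a<n = trans (countBelow-between n a (suc a) (n≤1+n a) a<n) (m+n∸n≡m 1 a)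

length-filterᵇ-∷ : ∀ {A : Set} (p : A → Bool) x xs →
  length (filterᵇ p (x ∷ xs)) ≡ boolToℕ (p x) + length (filterᵇ p xs)
length-filterᵇ-∷ p x xs with p x
... | true = refl
... | false = refl

length-filterᵇ-tabulate : ∀ n {A : Set} (f : Fin n → A) (p : A → Bool) (q : ℕ → Bool) →
  (∀ i → p (f i) ≡ q (toℕ i)) → length (filterᵇ p (tabulate f)) ≡ countBelow n q
length-filterᵇ-tabulate zero f p q h = refl
length-filterᵇ-tabulate (suc n) f p q h = begin
    length (filterᵇ p (f fzero ∷ tabulate (f ∘ fsuc)))
  ≡⟨ length-filterᵇ-∷ p (f fzero) _ ⟩
    boolToℕ (p (f fzero)) + length (filterᵇ p (tabulate (f ∘ fsuc)))
  ≡⟨ cong₂ _+_ (cong boolToℕ (h fzero)) (length-filterᵇ-tabulate n (f ∘ fsuc) p (q ∘ suc) (h ∘ fsuc)) ⟩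
    boolToℕ (q 0) + countBelow n (q ∘ suc)
  ≡⟨ countBelow-suc-shift n q ⟨
    countBelow (suc n) q ∎
  where open ≡-Reasoning

length-filterᵇ-allFin : ∀ n (p : Fin n → Bool) (q : ℕ → Bool) →
  (∀ i → p i ≡ q (toℕ i)) → length (filterᵇ p (allFin n)) ≡ countBelow n q
length-filterᵇ-allFin n p q h = length-filterᵇ-tabulate n id p q h

length-filterᵇ-mono : ∀ {A : Set} (p q : A → Bool) xs → (∀ x → q x ≡ true → p x ≡ true) →
  length (filterᵇ q xs) ≤ length (filterᵇ p xs)
length-filterᵇ-mono p q [] h = z≤n
length-filterᵇ-mono p q (x ∷ xs) h rewrite length-filterᵇ-∷ p x xs | length-filterᵇ-∷ q x xs =
  +-mono-≤ (boolToℕ-mono (h x)) (length-filterᵇ-mono p q xs h)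

length-filterᵇ-pos : ∀ {A : Set} (q : A → Bool) {x} xs → x ∈ xs → q x ≡ true → 1 ≤ length (filterᵇ q xs)
length-filterᵇ-pos q (y ∷ ys) x∈ qx = ≤-trans (go x∈ qx) (≤-reflexive (sym (length-filterᵇ-∷ q y ys)))
  where
  go : ∀ {z} → z ∈ y ∷ ys → q z ≡ true → 1 ≤ boolToℕ (q y) + length (filterᵇ q ys)
  go (here refl) qz rewrite qz = s≤s z≤n
  go (there z∈) qz = ≤-trans (length-filterᵇ-pos q ys z∈ qz) (m≤n+m _ _)

length-filterᵇ-none : ∀ {A : Set} (q : A → Bool) xs → (∀ {x} → x ∈ xs → q x ≡ false) → length (filterᵇ q xs) ≡ 0
length-filterᵇ-none q [] h = refl
length-filterᵇ-none q (y ∷ ys) h = trans (length-filterᵇ-∷ q y ys)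
  (cong₂ _+_ (cong boolToℕ (h (here refl))) (length-filterᵇ-none q ys (h ∘ there)))

∈-filterᵇ⁺ : ∀ {A : Set} (p : A → Bool) {x xs} → x ∈ xs → p x ≡ true → x ∈ filterᵇ p xs
∈-filterᵇ⁺ p {x} {xs} x∈ px = ∈-filter⁺ (T? ∘ p) {xs = xs} x∈ (subst T (sym px) tt)

∈-filterᵇ⁻ : ∀ {A : Set} (p : A → Bool) {x} xs → x ∈ filterᵇ p xs → p x ≡ true
∈-filterᵇ⁻ p {x} xs x∈ = T⇒≡true (p x) (proj₂ (∈-filter⁻ (T? ∘ p) {xs = xs} x∈))
  where
  T⇒≡true : ∀ b → T b → b ≡ true
  T⇒≡true true _ = refl

filterᵇ-filterᵇ : ∀ {A : Set} (p q : A → Bool) xs → filterᵇ q (filterᵇ p xs) ≡ filterᵇ (λ x → p x ∧ q x) xs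
filterᵇ-filterᵇ p q [] = refl
filterᵇ-filterᵇ p q (x ∷ xs) with p x
... | false = filterᵇ-filterᵇ p q xs
... | true with q x
...   | true = cong (x ∷_) (filterᵇ-filterᵇ p q xs)
...   | false = filterᵇ-filterᵇ p q xs

sum-map-const : ∀ {A : Set} (f : A → ℕ) c xs → (∀ {x} → x ∈ xs → f x ≡ c) → sum (map f xs) ≡ length xs * c
sum-map-const f c [] h = refl
sum-map-const f c (x ∷ xs) h = cong₂ _+_ (h (here refl)) (sum-map-const f c xs (h ∘ there))

-- Graphs described by relations on vertex indices

SameEdge : ℕ → ℕ → ℕ → ℕ → Set
SameEdge p q a b = (a ≡ p × b ≡ q) ⊎ (a ≡ q × b ≡ p)

SameEdge-swap : ∀ {p q a b} → SameEdge q p a b → SameEdge p q a b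
SameEdge-swap (inj₁ (a≡q , b≡p)) = inj₂ (a≡q , b≡p)
SameEdge-swap (inj₂ (a≡p , b≡q)) = inj₁ (a≡p , b≡q)

Sym : (ℕ → ℕ → Set) → ℕ → ℕ → Set
Sym Q a b = Q a b ⊎ Q b a

Sym-∷ : ∀ {Q Q′ : ℕ → ℕ → Set} p q →
  (∀ a b → (Q′ a b → (a ≡ p × b ≡ q) ⊎ Q a b) × ((a ≡ p × b ≡ q) ⊎ Q a b → Q′ a b)) →
  ∀ a b → (Sym Q′ a b → SameEdge p q a b ⊎ Sym Q a b) × (SameEdge p q a b ⊎ Sym Q a b → Sym Q′ a b)
Sym-∷ {Q} {Q′} p q h a b = to , from
  where
  to : Sym Q′ a b → SameEdge p q a b ⊎ Sym Q a b
  to (inj₁ x) with proj₁ (h a b) x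
  ... | inj₁ e = inj₁ (inj₁ e)
  ... | inj₂ y = inj₂ (inj₁ y)
  to (inj₂ x) with proj₁ (h b a) x
  ... | inj₁ (b≡p , a≡q) = inj₁ (inj₂ (a≡q , b≡p))
  ... | inj₂ y = inj₂ (inj₂ y)
  from : SameEdge p q a b ⊎ Sym Q a b → Sym Q′ a b
  from (inj₁ (inj₁ e)) = inj₁ (proj₂ (h a b) (inj₁ e))
  from (inj₁ (inj₂ (a≡q , b≡p))) = inj₂ (proj₂ (h b a) (inj₁ (b≡p , a≡q)))
  from (inj₂ (inj₁ y)) = inj₁ (proj₂ (h a b) (inj₂ y))
  from (inj₂ (inj₂ y)) = inj₂ (proj₂ (h b a) (inj₂ y))

≤-suc⁻ : ∀ {b c} → b ≤ suc c → b ≡ suc c ⊎ b ≤ c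
≤-suc⁻ b≤1+c with m≤n⇒m<n∨m≡n b≤1+c
... | inj₁ b<1+c = inj₂ (≤-pred b<1+c)
... | inj₂ b≡1+c = inj₁ b≡1+c

module _ {n : ℕ} where

  sameFin≡true⇒ : (a x : Fin n) → sameFin a x ≡ true → toℕ a ≡ toℕ x
  sameFin≡true⇒ a x e with a Data.Fin.≟ x
  ... | yes refl = refl
  sameFin≡true⇒ a x () | no _

  sameFin≡true : (a x : Fin n) → toℕ a ≡ toℕ x → sameFin a x ≡ true
  sameFin≡true a x e with a Data.Fin.≟ x
  ... | yes _ = refl
  ... | no a≢x = ⊥-elim (a≢x (toℕ-injective e))

  sameFin≡false : (a x : Fin n) → toℕ a ≢ toℕ x → sameFin a x ≡ false
  sameFin≡false a x ne = ≢true⇒≡false (ne ∘ sameFin≡true⇒ a x)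

  adj-∷⁻ : ∀ (E : Graph n) u v x y → adj ((u , v) ∷ E) x y ≡ true →
    SameEdge (toℕ u) (toℕ v) (toℕ x) (toℕ y) ⊎ adj E x y ≡ true
  adj-∷⁻ E u v x y e with ∨≡true⁻ _ _ e
  ... | inj₁ uxvy = let (ux , vy) = ∧≡true⁻ _ _ uxvy in
    inj₁ (inj₁ (sym (sameFin≡true⇒ u x ux) , sym (sameFin≡true⇒ v y vy)))
  ... | inj₂ e′ with ∨≡true⁻ _ _ e′
  ...   | inj₂ e″ = inj₂ e″
  ...   | inj₁ uyvx = let (uy , vx) = ∧≡true⁻ _ _ uyvx in
    inj₁ (inj₂ (sym (sameFin≡true⇒ v x vx) , sym (sameFin≡true⇒ u y uy)))

  adj-∷⁺ : ∀ (E : Graph n) u v x y →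
    SameEdge (toℕ u) (toℕ v) (toℕ x) (toℕ y) ⊎ adj E x y ≡ true → adj ((u , v) ∷ E) x y ≡ true
  adj-∷⁺ E u v x y (inj₁ (inj₁ (x≡u , y≡v))) =
    ∨≡trueˡ _ _ (∧≡true⁺ (sameFin≡true u x (sym x≡u)) (sameFin≡true v y (sym y≡v)))
  adj-∷⁺ E u v x y (inj₁ (inj₂ (x≡v , y≡u))) =
    ∨≡trueʳ (sameFin u x ∧ sameFin v y) _
      (∨≡trueˡ _ (adj E x y) (∧≡true⁺ (sameFin≡true u y (sym y≡u)) (sameFin≡true v x (sym x≡v))))
  adj-∷⁺ E u v x y (inj₂ e) = ∨≡trueʳ (sameFin u x ∧ sameFin v y) _ (∨≡trueʳ (sameFin u y ∧ sameFin v x) _ e)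

  record Describes (E : Graph n) (R : ℕ → ℕ → Set) : Set where
    field
      adj⇒ : ∀ {x y} → adj E x y ≡ true → R (toℕ x) (toℕ y)
      ⇒adj : ∀ {x y} → R (toℕ x) (toℕ y) → adj E x y ≡ true

  open Describes public

  ¬⇒adj≡false : ∀ {E R} → Describes E R → ∀ {x y} → ¬ R (toℕ x) (toℕ y) → adj E x y ≡ false
  ¬⇒adj≡false g ¬r = ≢true⇒≡false (¬r ∘ adj⇒ g)

  Describes-∷ : ∀ {E R R′} u v {p q} → toℕ u ≡ p → toℕ v ≡ q →
    (∀ a b → (R′ a b → SameEdge p q a b ⊎ R a b) × (SameEdge p q a b ⊎ R a b → R′ a b)) →
    Describes E R → Describes ((u , v) ∷ E) R′
  Describes-∷ {E} {R′ = R′} u v refl refl h g = record { adj⇒ = to ; ⇒adj = from }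
    where
    to : ∀ {x y} → adj ((u , v) ∷ E) x y ≡ true → R′ (toℕ x) (toℕ y)
    to {x} {y} e with adj-∷⁻ E u v x y e
    ... | inj₁ same = proj₂ (h _ _) (inj₁ same)
    ... | inj₂ e′ = proj₂ (h _ _) (inj₂ (adj⇒ g e′))
    from : ∀ {x y} → R′ (toℕ x) (toℕ y) → adj ((u , v) ∷ E) x y ≡ true
    from {x} {y} r with proj₁ (h _ _) r
    ... | inj₁ same = adj-∷⁺ E u v x y (inj₁ same)
    ... | inj₂ r′ = adj-∷⁺ E u v x y (inj₂ (⇒adj g r′))

  Within : Graph n → (ℕ → ℕ → Set) → Set
  Within E R = ∀ x y → adj E x y ≡ true → R (toℕ x) (toℕ y)

  Within-∷ : ∀ {E R R′} u v → (∀ a b → SameEdge (toℕ u) (toℕ v) a b ⊎ R a b → R′ a b) →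
    Within E R → Within ((u , v) ∷ E) R′
  Within-∷ {E} u v h g x y e with adj-∷⁻ E u v x y e
  ... | inj₁ same = h _ _ (inj₁ same)
  ... | inj₂ e′ = h _ _ (inj₂ (g x y e′))

  Within-weaken : ∀ {E R R′} → (∀ a b → R a b → R′ a b) → Within E R → Within E R′
  Within-weaken h g x y e = h _ _ (g x y e)

  deg≡countBelow : ∀ {E R} → Describes E R → ∀ x (q : ℕ → Bool) →
    (∀ b → b < n → (R (toℕ x) b → q b ≡ true) × (q b ≡ true → R (toℕ x) b)) → deg E x ≡ countBelow n q
  deg≡countBelow {E} g x q h = length-filterᵇ-allFin n (adj E x) q λ i →
    ≡-from-≡true (proj₁ (h (toℕ i) (toℕ<n i)) ∘ adj⇒ g) (⇒adj g ∘ proj₂ (h (toℕ i) (toℕ<n i)))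

  countBelow≤deg : ∀ (E : Graph n) x (q : ℕ → Bool) → (∀ y → q (toℕ y) ≡ true → adj E x y ≡ true) →
    countBelow n q ≤ deg E x
  countBelow≤deg E x q h = ≤-trans (≤-reflexive (sym (length-filterᵇ-allFin n (q ∘ toℕ) q λ _ → refl)))
                                   (length-filterᵇ-mono (adj E x) (q ∘ toℕ) (allFin n) h)

  ∈-neighbours : ∀ {E : Graph n} {x y} → adj E x y ≡ true → y ∈ neighbours E x
  ∈-neighbours {E} {x} {y} e = ∈-filterᵇ⁺ (adj E x) {y} {allFin n} (∈-allFin y) e

  neighbours⇒adj : ∀ {E : Graph n} {x y} → y ∈ neighbours E x → adj E x y ≡ true
  neighbours⇒adj {E} {x} = ∈-filterᵇ⁻ (adj E x) (allFin n)

  neighbours-unique : ∀ (E : Graph n) x → Unique (neighbours E x)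
  neighbours-unique E x = Unique.filter⁺ (T? ∘ adj E x) (Unique.allFin⁺ n)

  deg-∷-pos : ∀ (E : Graph n) u v → 1 ≤ deg ((u , v) ∷ E) u
  deg-∷-pos E u v = length-filterᵇ-pos (adj ((u , v) ∷ E) u) (allFin n) (∈-allFin v)
                                        (adj-∷⁺ E u v u v (inj₁ (inj₁ (refl , refl))))

  mcount≡0 : ∀ E (M : State n) y → (∀ x → adj E y x ≡ true → M x ≡ false) → mcount E M y ≡ 0
  mcount≡0 E M y h = length-filterᵇ-none M (neighbours E y) (λ x∈ → h _ (neighbours⇒adj {E} x∈))

  mcount-pos : ∀ E (M : State n) y x → adj E y x ≡ true → M x ≡ true → 1 ≤ mcount E M y
  mcount-pos E M y x e Mx = length-filterᵇ-pos M (neighbours E y) (∈-neighbours {E} e) Mx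

  set-≡ : ∀ (M : State n) y b → set M y b y ≡ b
  set-≡ M y b rewrite sameFin≡true y y refl = refl

  set-≢ : ∀ (M : State n) y b x → toℕ y ≢ toℕ x → set M y b x ≡ M x
  set-≢ M y b x ne rewrite sameFin≡false y x ne = refl

  set-true-mono : ∀ (M : State n) y x → M x ≡ true → set M y true x ≡ true
  set-true-mono M y x Mx with sameFin y x
  ... | true = refl
  ... | false = Mx

  member-not-addable : ∀ E (M : State n) y → M y ≡ true → (not (M y) ∧ (mcount E M y ≡ᵇ 0)) ≡ false
  member-not-addable E M y My rewrite My = refl

  dominated-not-addable : ∀ E (M : State n) y x → adj E y x ≡ true → M x ≡ true →
    (not (M y) ∧ (mcount E M y ≡ᵇ 0)) ≡ false
  dominated-not-addable E M y x e Mx with mcount E M y | mcount-pos E M y x e Mx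
  ... | suc _ | _ = ∧-zeroʳ (not (M y))

  addFree-none : ∀ E (M : State n) L → (∀ {y} → y ∈ L → (not (M y) ∧ (mcount E M y ≡ᵇ 0)) ≡ false) →
    addFree E M L ≡ (M , 0)
  addFree-none E M [] h = refl
  addFree-none E M (y ∷ ys) h rewrite h (here refl) = addFree-none E M ys (h ∘ there)

  module AddFree (E : Graph n) (S : Fin n → Bool) where

    TargetsFree : State n → Set
    TargetsFree M = ∀ y x → S y ≡ true → adj E y x ≡ true → M x ≡ false × S x ≡ false

    Blocked : State n → Fin n → Set
    Blocked M y = M y ≡ true ⊎ Σ (Fin n) (λ x → adj E y x ≡ true × M x ≡ true × S x ≡ false)

    TargetsFree-set : ∀ {M} y → S y ≡ true → TargetsFree M → TargetsFree (set M y true)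
    TargetsFree-set {M} y Sy free z x Sz e with sameFin y x in y≟x
    ... | true rewrite toℕ-injective (sameFin≡true⇒ y x y≟x) =
      ⊥-elim (false≢true (trans (sym (proj₂ (free z x Sz e))) Sy))
    ... | false = free z x Sz e

    Blocked-set : ∀ {M} y z → Blocked M z → Blocked (set M y true) z
    Blocked-set {M} y z (inj₁ Mz) = inj₁ (set-true-mono M y z Mz)
    Blocked-set {M} y z (inj₂ (x , e , Mx , Sx)) = inj₂ (x , e , set-true-mono M y x Mx , Sx)

    Blocked⇒not-addable : ∀ {M} y → Blocked M y → (not (M y) ∧ (mcount E M y ≡ᵇ 0)) ≡ false
    Blocked⇒not-addable {M} y (inj₁ My) = member-not-addable E M y My
    Blocked⇒not-addable {M} y (inj₂ (x , e , Mx , _)) = dominated-not-addable E M y x e Mx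

    target-addable : ∀ {M} y → M y ≡ false → S y ≡ true → TargetsFree M →
      (not (M y) ∧ (mcount E M y ≡ᵇ 0)) ≡ true
    target-addable {M} y My Sy free rewrite My | mcount≡0 E M y (λ x e → proj₁ (free y x Sy e)) = refl

    AddsExactly : State n → List (Fin n) → Set
    AddsExactly M L = (∀ x → proj₁ (addFree E M L) x ≡ M x ∨ S x) × proj₂ (addFree E M L) ≡ sum (map (deg E) (filterᵇ S L))

    -- Targets are pairwise non-adjacent and see no vertex of M, so each is added when
    -- reached, while every other listed vertex stays blocked by a member of M.
    addFree-exact : ∀ L (M : State n) → Unique L →
      (∀ {y} → y ∈ L → S y ≡ true → M y ≡ false) → TargetsFree M →
      (∀ {y} → y ∈ L → S y ≡ false → Blocked M y) → (∀ x → S x ≡ true → x ∉ L → M x ≡ true) →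
      AddsExactly M L
    addFree-exact [] M _ _ _ _ covered = final , refl
      where
      final : ∀ x → M x ≡ M x ∨ S x
      final x with S x in Sx
      ... | true = trans (covered x Sx λ ()) (sym (∨-zeroʳ (M x)))
      ... | false = sym (∨-identityʳ (M x))
    addFree-exact (y ∷ ys) M (y∉ys ∷ unique) out free blocked covered with S y in Sy
    ... | true = final , cost
      where
      IH : AddsExactly (set M y true) ys
      IH = addFree-exact ys (set M y true) unique
             (λ {z} z∈ Sz → trans (set-≢ M y true z (All.lookup y∉ys z∈ ∘ toℕ-injective)) (out (there z∈) Sz))
             (TargetsFree-set y Sy free)
             (λ {z} z∈ Sz → Blocked-set y z (blocked (there z∈) Sz))
             (λ x Sx x∉ys → set-covered x Sx x∉ys)
        where
        set-covered : ∀ x → S x ≡ true → x ∉ ys → set M y true x ≡ true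
        set-covered x Sx x∉ys with sameFin y x in y≟x
        ... | true = refl
        ... | false = covered x Sx λ { (here refl) → false≢true (trans (sym y≟x) (sameFin≡true y y refl))
                                      ; (there x∈) → x∉ys x∈ }
      addable : (not (M y) ∧ (mcount E M y ≡ᵇ 0)) ≡ true
      addable = target-addable y (out (here refl) Sy) Sy free
      final : ∀ x → proj₁ (addFree E M (y ∷ ys)) x ≡ M x ∨ S x
      final x rewrite addable = trans (proj₁ IH x) (absorb x)
        where
        absorb : ∀ x → set M y true x ∨ S x ≡ M x ∨ S x
        absorb x with sameFin y x in y≟x
        ... | true rewrite sym (toℕ-injective (sameFin≡true⇒ y x y≟x)) | Sy = sym (∨-zeroʳ (M y))
        ... | false = refl
      cost : proj₂ (addFree E M (y ∷ ys)) ≡ sum (map (deg E) (y ∷ filterᵇ S ys))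
      cost rewrite addable = cong (deg E y +_) (proj₂ IH)
    ... | false = final , cost
      where
      IH : AddsExactly M ys
      IH = addFree-exact ys M unique (out ∘ there) free (blocked ∘ there)
             (λ x Sx x∉ys → covered x Sx λ { (here refl) → false≢true (trans (sym Sy) Sx)
                                           ; (there x∈) → x∉ys x∈ })
      not-addable : (not (M y) ∧ (mcount E M y ≡ᵇ 0)) ≡ false
      not-addable = Blocked⇒not-addable y (blocked (here refl) Sy)
      final : ∀ x → proj₁ (addFree E M (y ∷ ys)) x ≡ M x ∨ S x
      final x rewrite not-addable = proj₁ IH x
      cost : proj₂ (addFree E M (y ∷ ys)) ≡ sum (map (deg E) (filterᵇ S ys))
      cost rewrite not-addable = proj₂ IH

record Outside {n} (M : State n) (P : ℕ → Set) : Set where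
  field
    out⇒ : ∀ {x} → M x ≡ false → P (toℕ x)
    ⇒out : ∀ {x} → P (toℕ x) → M x ≡ false

open Outside public

module _ {n : ℕ} {M : State n} {P : ℕ → Set} where

  Outside-member : Outside M P → ∀ x → ¬ P (toℕ x) → M x ≡ true
  Outside-member o x ¬Px with M x in Mx
  ... | true = refl
  ... | false = ⊥-elim (¬Px (out⇒ o Mx))

  Outside-remove : ∀ {P′} w {p} → toℕ w ≡ p → Outside M P →
    (∀ a → (P′ a → P a ⊎ a ≡ p) × (P a ⊎ a ≡ p → P′ a)) → Outside (set M w false) P′
  Outside-remove {P′} w refl o h = record { out⇒ = to ; ⇒out = from }
    where
    to : ∀ {x} → set M w false x ≡ false → P′ (toℕ x)
    to {x} e with sameFin w x in w≟x
    ... | true = proj₂ (h _) (inj₂ (sym (sameFin≡true⇒ w x w≟x)))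
    ... | false = proj₂ (h _) (inj₁ (out⇒ o e))
    from : ∀ {x} → P′ (toℕ x) → set M w false x ≡ false
    from {x} p′ with sameFin w x in w≟x | proj₁ (h _) p′
    ... | true | _ = refl
    ... | false | inj₁ p = ⇒out o p
    ... | false | inj₂ x≡w = ⊥-elim (false≢true (trans (sym w≟x) (sameFin≡true w x (sym x≡w))))

  Outside-∨ : ∀ {M′ : State n} {P′} (s : ℕ → Bool) → Outside M P → (∀ x → M′ x ≡ M x ∨ s (toℕ x)) →
    (∀ a → (P′ a → P a × s a ≡ false) × (P a × s a ≡ false → P′ a)) → Outside M′ P′
  Outside-∨ {M′} {P′} s o M′≡ h = record { out⇒ = to ; ⇒out = from }
    where
    to : ∀ {x} → M′ x ≡ false → P′ (toℕ x)
    to {x} e with M x in Mx | s (toℕ x) in sx | M′≡ x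
    ... | false | false | _ = proj₂ (h _) (out⇒ o Mx , sx)
    ... | true | _ | e′ = ⊥-elim (false≢true (trans (sym e) e′))
    ... | false | true | e′ = ⊥-elim (false≢true (trans (sym e) e′))
    from : ∀ {x} → P′ (toℕ x) → M′ x ≡ false
    from {x} p′ = let (p , sx) = proj₁ (h _) p′ in trans (M′≡ x) (cong₂ _∨_ (⇒out o p) sx)

module _ {n : ℕ} where

  insertStep-cheap : ∀ (E : Graph n) M u v → M u ∧ M v ≡ false → insertStep E M (u , v) ≡ ((u , v) ∷ E , M , 1)
  insertStep-cheap E M u v eq rewrite eq = refl

  insertStep-evicts : ∀ (E : Graph n) M u v → M u ≡ true → M v ≡ true →
    deg ((u , v) ∷ E) v ≤ deg ((u , v) ∷ E) u →
    let E′ = (u , v) ∷ E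
        r = addFree E′ (set M v false) (neighbours E′ v)
    in insertStep E M (u , v) ≡ (E′ , proj₁ r , suc (deg E′ v + proj₂ r))
  insertStep-evicts E M u v Mu Mv le rewrite Mu | Mv | ≤⇒≤ᵇ≡true le = refl

  insertStep-evicts-only : ∀ (E : Graph n) M u v → M u ≡ true → M v ≡ true →
    deg ((u , v) ∷ E) v ≤ deg ((u , v) ∷ E) u →
    (∀ y → adj ((u , v) ∷ E) v y ≡ true →
       (not (set M v false y) ∧ (mcount ((u , v) ∷ E) (set M v false) y ≡ᵇ 0)) ≡ false) →
    insertStep E M (u , v) ≡ ((u , v) ∷ E , set M v false , suc (deg ((u , v) ∷ E) v + 0))
  insertStep-evicts-only E M u v Mu Mv le h rewrite insertStep-evicts E M u v Mu Mv le
    | addFree-none ((u , v) ∷ E) (set M v false) (neighbours ((u , v) ∷ E) v)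
        (λ y∈ → h _ (neighbours⇒adj {E = (u , v) ∷ E} y∈)) = refl

  insertStep-cost-pos : ∀ (E : Graph n) M e → 1 ≤ proj₂ (proj₂ (insertStep E M e))
  insertStep-cost-pos E M (u , v) with M u ∧ M v
  ... | true = s≤s z≤n
  ... | false = s≤s z≤n

  runCost-∷ : ∀ (E : Graph n) M e es {E′ M′ c} → insertStep E M e ≡ (E′ , M′ , c) →
    runCost E M (e ∷ es) ≡ c + runCost E′ M′ es
  runCost-∷ E M e es eq rewrite eq = refl

  length≤runCost : ∀ (E : Graph n) M s → length s ≤ runCost E M s
  length≤runCost E M [] = z≤n
  length≤runCost E M (e ∷ s) = +-mono-≤ (insertStep-cost-pos E M e) (length≤runCost _ _ s)

  runCost-cheap : ∀ E (M : State n) s → All (λ uv → M (proj₂ uv) ≡ false) s → runCost E M s ≡ length s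
  runCost-cheap E M [] _ = refl
  runCost-cheap E M ((u , v) ∷ s) (Mv ∷ Ms) =
    trans (runCost-∷ E M (u , v) s (insertStep-cheap E M u v (trans (cong (M u ∧_) Mv) (∧-zeroʳ (M u)))))
          (cong suc (runCost-cheap ((u , v) ∷ E) M s Ms))

  ValidSeq-take : ∀ t (E : Graph n) s → ValidSeq E s → ValidSeq E (take t s)
  ValidSeq-take zero E s _ = tt
  ValidSeq-take (suc t) E [] _ = tt
  ValidSeq-take (suc t) E ((u , w) ∷ s) (u≢w , fresh , valid) = u≢w , fresh , ValidSeq-take t ((u , w) ∷ E) s valid

  Realises : Graph n → State n → List (Edge n) → ℕ → Set
  Realises E M s K = ValidSeq E s × runCost E M s ≡ K

  Realises-∷ : ∀ (E : Graph n) M u v es {M′ c K} → u ≢ v → adj E u v ≡ false →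
    insertStep E M (u , v) ≡ ((u , v) ∷ E , M′ , c) → Realises ((u , v) ∷ E) M′ es K →
    Realises E M ((u , v) ∷ es) (c + K)
  Realises-∷ E M u v es u≢v fresh eq (valid , cost) =
    (u≢v , fresh , valid) , trans (runCost-∷ E M (u , v) es eq) (cong (_ +_) cost)

-- Triangular and tetrahedral numbers

triangular : ℕ → ℕ
triangular zero = 0
triangular (suc n) = n + triangular n

tetrahedral : ℕ → ℕ
tetrahedral zero = 0
tetrahedral (suc n) = triangular n + tetrahedral n

nC2≡triangular : ∀ n → n C 2 ≡ triangular n
nC2≡triangular zero = refl
nC2≡triangular (suc n) = trans (sym (nCk+nC[k+1]≡[n+1]C[k+1] n 1)) (cong₂ _+_ (nC1≡n n) (nC2≡triangular n))

triangular-+ : ∀ a b → triangular (a + b) ≡ triangular a + triangular b + a * b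
triangular-+ zero b = sym (+-identityʳ (triangular b))
triangular-+ (suc a) b = trans (cong ((a + b) +_) (triangular-+ a b)) (ring a b (triangular a) (triangular b))
  where
  ring : ∀ a b x y → (a + b) + (x + y + a * b) ≡ (a + x) + y + suc a * b
  ring = solve-∀

triangular≤square : ∀ n → triangular n ≤ n * n
triangular≤square zero = z≤n
triangular≤square (suc n) = begin
    n + triangular n      ≤⟨ +-monoʳ-≤ n (triangular≤square n) ⟩
    n + n * n             ≤⟨ m≤n+m _ (suc n) ⟩
    suc n + (n + n * n)   ≡⟨ ring n ⟩
    suc n * suc n         ∎
  where
  open ≤-Reasoning
  ring : ∀ n → suc n + (n + n * n) ≡ suc n * suc n
  ring = solve-∀

triangular<square : ∀ n → 1 ≤ n → triangular n < n * n
triangular<square (suc n) _ = begin-strict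
    n + triangular n      ≤⟨ +-monoʳ-≤ n (triangular≤square n) ⟩
    n + n * n             <⟨ m<n+m _ {suc n} z<s ⟩
    suc n + (n + n * n)   ≡⟨ ring n ⟩
    suc n * suc n         ∎
  where
  open ≤-Reasoning
  ring : ∀ n → suc n + (n + n * n) ≡ suc n * suc n
  ring = solve-∀

6*tetrahedral : ∀ c → 6 * tetrahedral (suc (suc c)) ≡ c * suc c * suc (suc c)
6*tetrahedral zero = refl
6*tetrahedral (suc c) = begin
    6 * (triangular (suc (suc c)) + tetrahedral (suc (suc c)))
  ≡⟨ *-distribˡ-+ 6 (triangular (suc (suc c))) _ ⟩
    6 * triangular (suc (suc c)) + 6 * tetrahedral (suc (suc c))
  ≡⟨ cong₂ _+_ (trans (*-assoc 3 2 (triangular (suc (suc c)))) (cong (3 *_) (2*triangular (suc c)))) (6*tetrahedral c) ⟩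
    3 * (suc c * suc (suc c)) + c * suc c * suc (suc c)
  ≡⟨ ring c ⟩
    suc c * suc (suc c) * suc (suc (suc c)) ∎
  where
  open ≡-Reasoning
  2*triangular : ∀ c → 2 * triangular (suc c) ≡ c * suc c
  2*triangular zero = refl
  2*triangular (suc c) = trans (*-distribˡ-+ 2 (suc c) (triangular (suc c)))
                               (trans (cong (2 * suc c +_) (2*triangular c)) (ring₂ c))
    where
    ring₂ : ∀ c → 2 * suc c + c * suc c ≡ suc c * suc (suc c)
    ring₂ = solve-∀
  ring : ∀ c → 3 * (suc c * suc (suc c)) + c * suc c * suc (suc c) ≡ suc c * suc (suc c) * suc (suc (suc c))
  ring = solve-∀

cube≤96*tetrahedral : ∀ j → (j + 4) * ((j + 4) * (j + 4)) ≤ 96 * tetrahedral (j + 3)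
cube≤96*tetrahedral j = begin
    (j + 4) * ((j + 4) * (j + 4))
  ≤⟨ m≤m+n _ _ ⟩
    (j + 4) * ((j + 4) * (j + 4)) + (15 * (j * (j * j)) + 84 * (j * j) + 128 * j + 32)
  ≡⟨ ring j ⟩
    16 * (suc j * suc (suc j) * suc (suc (suc j)))
  ≡⟨ cong (16 *_) (sym (trans (cong (λ t → 6 * tetrahedral t) (+-comm j 3)) (6*tetrahedral (suc j)))) ⟩
    16 * (6 * tetrahedral (j + 3))
  ≡⟨ sym (*-assoc 16 6 (tetrahedral (j + 3))) ⟩
    96 * tetrahedral (j + 3) ∎
  where
  open ≤-Reasoning
  ring : ∀ j → (j + 4) * ((j + 4) * (j + 4)) + (15 * (j * (j * j)) + 84 * (j * j) + 128 * j + 32) ≡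
               16 * (suc j * suc (suc j) * suc (suc (suc j)))
  ring = solve-∀

halfSqrt : ∀ m → ∃[ k ] (4 * (k * k) ≤ m × m < 4 * (suc k * suc k))
halfSqrt zero = 0 , z≤n , s≤s z≤n
halfSqrt (suc m) with halfSqrt m
... | (k , lower , upper) with m≤n⇒m<n∨m≡n upper
...   | inj₁ 1+m<bound = k , m≤n⇒m≤1+n lower , 1+m<bound
...   | inj₂ 1+m≡bound = suc k , ≤-reflexive (sym 1+m≡bound) ,
                         subst (_< 4 * (suc (suc k) * suc (suc k))) (sym 1+m≡bound)
                               (*-monoʳ-< 4 (*-mono-< (n<1+n (suc k)) (n<1+n (suc k))))

n≤n*n : ∀ n → n ≤ n * n
n≤n*n zero = z≤n
n≤n*n (suc n) = m≤m+n (suc n) (n * suc n)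

^2≡ : ∀ x → x ^ 2 ≡ x * x
^2≡ x = cong (x *_) (*-identityʳ x)

^3≡ : ∀ x → x ^ 3 ≡ x * (x * x)
^3≡ x = cong (λ t → x * (x * t)) (*-identityʳ x)

-- The hard instance

fin : (m : ℕ) → ℕ → Fin (suc m)
fin m zero = fzero
fin zero (suc a) = fzero
fin (suc m) (suc a) = fsuc (fin m a)

toℕ-fin : ∀ m a → a ≤ m → toℕ (fin m a) ≡ a
toℕ-fin m zero _ = refl
toℕ-fin (suc m) (suc a) (s≤s a≤m) = cong suc (toℕ-fin m a a≤m)

-- Vertex k is the hub and k+1, …, k+d its pendant leaves; vertices 0, …, k−1 carry the rounds.
module Graphs (k d : ℕ) where

  -- After i leaves, r completed rounds, and round r joined to r+1, …, j.
  Edges : ℕ → ℕ → ℕ → ℕ → ℕ → Set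
  Edges i r j a b = (a ≡ k × k < b × b ≤ k + i) ⊎ (a < r × a < b × b ≤ k) ⊎ (a ≡ r × r < b × b ≤ j)

  Evicted : ℕ → ℕ → ℕ → ℕ → Set
  Evicted i r j a = (k < a × a ≤ k + i) ⊎ a < r ⊎ (r < a × a ≤ j)

  Edges-leaf : ∀ i a b → (Edges (suc i) 0 0 a b → (a ≡ k × b ≡ k + suc i) ⊎ Edges i 0 0 a b) ×
                        ((a ≡ k × b ≡ k + suc i) ⊎ Edges i 0 0 a b → Edges (suc i) 0 0 a b)
  Edges-leaf i a b = to , from
    where
    to : Edges (suc i) 0 0 a b → (a ≡ k × b ≡ k + suc i) ⊎ Edges i 0 0 a b
    to (inj₁ (e , p , q)) with ≤-suc⁻ (subst (b ≤_) (+-suc k i) q)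
    ... | inj₁ e′ = inj₁ (e , trans e′ (sym (+-suc k i)))
    ... | inj₂ q′ = inj₂ (inj₁ (e , p , q′))
    to (inj₂ (inj₁ (() , _)))
    to (inj₂ (inj₂ (e , p , q))) = ⊥-elim (<⇒≱ p q)
    from : (a ≡ k × b ≡ k + suc i) ⊎ Edges i 0 0 a b → Edges (suc i) 0 0 a b
    from (inj₁ (e , e′)) = inj₁ (e , subst (k <_) (sym e′) (m<m+n k (s≤s z≤n)) , ≤-reflexive e′)
    from (inj₂ (inj₁ (e , p , q))) = inj₁ (e , p , ≤-trans q (+-monoʳ-≤ k (n≤1+n i)))
    from (inj₂ (inj₂ (inj₁ (() , _))))
    from (inj₂ (inj₂ (inj₂ (e , p , q)))) = ⊥-elim (<⇒≱ p q)

  Edges-star : ∀ r j → r ≤ j → ∀ a b → (Edges d r (suc j) a b → (a ≡ r × b ≡ suc j) ⊎ Edges d r j a b) ×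
                                        ((a ≡ r × b ≡ suc j) ⊎ Edges d r j a b → Edges d r (suc j) a b)
  Edges-star r j r≤j a b = to , from
    where
    to : Edges d r (suc j) a b → (a ≡ r × b ≡ suc j) ⊎ Edges d r j a b
    to (inj₁ x) = inj₂ (inj₁ x)
    to (inj₂ (inj₁ x)) = inj₂ (inj₂ (inj₁ x))
    to (inj₂ (inj₂ (e , p , q))) with ≤-suc⁻ q
    ... | inj₁ e′ = inj₁ (e , e′)
    ... | inj₂ q′ = inj₂ (inj₂ (inj₂ (e , p , q′)))
    from : (a ≡ r × b ≡ suc j) ⊎ Edges d r j a b → Edges d r (suc j) a b
    from (inj₁ (e , e′)) = inj₂ (inj₂ (e , subst (r <_) (sym e′) (s≤s r≤j) , ≤-reflexive e′))
    from (inj₂ (inj₁ x)) = inj₁ x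
    from (inj₂ (inj₂ (inj₁ x))) = inj₂ (inj₁ x)
    from (inj₂ (inj₂ (inj₂ (e , p , q)))) = inj₂ (inj₂ (e , p , m≤n⇒m≤1+n q))

  Edges-hub : ∀ r j → r ≤ j → suc j ≡ k → ∀ a b →
    (Edges d (suc r) (suc r) a b → (a ≡ r × b ≡ k) ⊎ Edges d r j a b) ×
    ((a ≡ r × b ≡ k) ⊎ Edges d r j a b → Edges d (suc r) (suc r) a b)
  Edges-hub r j r≤j j<k a b = to , from
    where
    to : Edges d (suc r) (suc r) a b → (a ≡ r × b ≡ k) ⊎ Edges d r j a b
    to (inj₁ x) = inj₂ (inj₁ x)
    to (inj₂ (inj₁ (p , q , s))) with m<1+n⇒m<n∨m≡n p
    ... | inj₁ p′ = inj₂ (inj₂ (inj₁ (p′ , q , s)))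
    ... | inj₂ refl with ≤-suc⁻ (subst (b ≤_) (sym j<k) s)
    ...   | inj₁ e′ = inj₁ (refl , trans e′ j<k)
    ...   | inj₂ s′ = inj₂ (inj₂ (inj₂ (refl , q , s′)))
    to (inj₂ (inj₂ (e , p , q))) = ⊥-elim (<⇒≱ p q)
    from : (a ≡ r × b ≡ k) ⊎ Edges d r j a b → Edges d (suc r) (suc r) a b
    from (inj₁ (e , e′)) = inj₂ (inj₁ (subst (_< suc r) (sym e) ≤-refl ,
                                      subst₂ _<_ (sym e) (sym e′) (subst (r <_) j<k (s≤s r≤j)) , ≤-reflexive e′))
    from (inj₂ (inj₁ x)) = inj₁ x
    from (inj₂ (inj₂ (inj₁ (p , q , s)))) = inj₂ (inj₁ (m≤n⇒m≤1+n p , q , s))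
    from (inj₂ (inj₂ (inj₂ (e , p , q)))) = inj₂ (inj₁ (subst (_< suc r) (sym e) ≤-refl , subst (_< b) (sym e) p ,
                                             ≤-trans q (subst (j ≤_) j<k (n≤1+n j))))

  Evicted-leaf : ∀ i a → (Evicted (suc i) 0 0 a → Evicted i 0 0 a ⊎ a ≡ k + suc i) ×
                         (Evicted i 0 0 a ⊎ a ≡ k + suc i → Evicted (suc i) 0 0 a)
  Evicted-leaf i a = to , from
    where
    to : Evicted (suc i) 0 0 a → Evicted i 0 0 a ⊎ a ≡ k + suc i
    to (inj₁ (p , q)) with ≤-suc⁻ (subst (a ≤_) (+-suc k i) q)
    ... | inj₁ e = inj₂ (trans e (sym (+-suc k i)))
    ... | inj₂ q′ = inj₁ (inj₁ (p , q′))
    to (inj₂ (inj₁ ()))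
    to (inj₂ (inj₂ (p , q))) = ⊥-elim (<⇒≱ p q)
    from : Evicted i 0 0 a ⊎ a ≡ k + suc i → Evicted (suc i) 0 0 a
    from (inj₁ (inj₁ (p , q))) = inj₁ (p , ≤-trans q (+-monoʳ-≤ k (n≤1+n i)))
    from (inj₁ (inj₂ (inj₁ ())))
    from (inj₁ (inj₂ (inj₂ (p , q)))) = ⊥-elim (<⇒≱ p q)
    from (inj₂ e) = inj₁ (subst (k <_) (sym e) (m<m+n k (s≤s z≤n)) , ≤-reflexive e)

  Evicted-star : ∀ r j → r ≤ j → ∀ a → (Evicted d r (suc j) a → Evicted d r j a ⊎ a ≡ suc j) ×
                                       (Evicted d r j a ⊎ a ≡ suc j → Evicted d r (suc j) a)
  Evicted-star r j r≤j a = to , from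
    where
    to : Evicted d r (suc j) a → Evicted d r j a ⊎ a ≡ suc j
    to (inj₁ x) = inj₁ (inj₁ x)
    to (inj₂ (inj₁ x)) = inj₁ (inj₂ (inj₁ x))
    to (inj₂ (inj₂ (p , q))) with ≤-suc⁻ q
    ... | inj₁ e = inj₂ e
    ... | inj₂ q′ = inj₁ (inj₂ (inj₂ (p , q′)))
    from : Evicted d r j a ⊎ a ≡ suc j → Evicted d r (suc j) a
    from (inj₁ (inj₁ x)) = inj₁ x
    from (inj₁ (inj₂ (inj₁ x))) = inj₂ (inj₁ x)
    from (inj₁ (inj₂ (inj₂ (p , q)))) = inj₂ (inj₂ (p , m≤n⇒m≤1+n q))
    from (inj₂ e) = inj₂ (inj₂ (subst (r <_) (sym e) (s≤s r≤j) , ≤-reflexive e))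

  -- Closing round r evicts r and readmits its star r+1, …, k−1.
  Evicted-hub : ∀ r j → r ≤ j → suc j ≡ k → ∀ a →
    (Evicted d (suc r) (suc r) a → (Evicted d r j a ⊎ a ≡ r) × between (suc r) k a ≡ false) ×
    ((Evicted d r j a ⊎ a ≡ r) × between (suc r) k a ≡ false → Evicted d (suc r) (suc r) a)
  Evicted-hub r j r≤j j<k a = to , from
    where
    outside : (suc r ≤ a × a < k → ⊥) → between (suc r) k a ≡ false
    outside h = ≢true⇒≡false (h ∘ between⁻ (suc r) k a)
    to : Evicted d (suc r) (suc r) a → (Evicted d r j a ⊎ a ≡ r) × between (suc r) k a ≡ false
    to (inj₁ (p , q)) = inj₁ (inj₁ (p , q)) , outside (λ (_ , y) → <⇒≱ y (<⇒≤ p))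
    to (inj₂ (inj₁ p)) with m<1+n⇒m<n∨m≡n p
    ... | inj₁ p′ = inj₁ (inj₂ (inj₁ p′)) , outside (λ (x , _) → <⇒≱ p x)
    ... | inj₂ e = inj₂ e , outside (λ (x , _) → <⇒≱ p x)
    to (inj₂ (inj₂ (p , q))) = ⊥-elim (<⇒≱ p q)
    from : (Evicted d r j a ⊎ a ≡ r) × between (suc r) k a ≡ false → Evicted d (suc r) (suc r) a
    from (inj₁ (inj₁ x) , _) = inj₁ x
    from (inj₁ (inj₂ (inj₁ x)) , _) = inj₂ (inj₁ (m≤n⇒m≤1+n x))
    from (inj₁ (inj₂ (inj₂ (p , q))) , e) = ⊥-elim (false≢true (trans (sym e) (between⁺ p (subst (a <_) j<k (s≤s q)))))
    from (inj₂ e , _) = inj₂ (inj₁ (subst (_< suc r) (sym e) ≤-refl))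

module Construction (n′ k d : ℕ) (k+d≤n′ : k + d ≤ n′) (k≤d : k ≤ d) where
  open Graphs k d public

  vertex : ℕ → Fin (suc n′)
  vertex = fin n′

  k≤k+d : k ≤ k + d
  k≤k+d = m≤m+n k d

  module _ {a : ℕ} (a≤ : a ≤ k + d) where

    toℕ-vertex : toℕ (vertex a) ≡ a
    toℕ-vertex = toℕ-fin n′ a (≤-trans a≤ k+d≤n′)

    vertex-≢ : ∀ {b} → b ≤ k + d → a ≢ b → vertex a ≢ vertex b
    vertex-≢ b≤ a≢b e = a≢b (trans (sym toℕ-vertex) (trans (cong toℕ e) (toℕ-fin n′ _ (≤-trans b≤ k+d≤n′))))

    vertex-fresh : ∀ {E R b} → Describes E R → b ≤ k + d → ¬ R a b → adj E (vertex a) (vertex b) ≡ false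
    vertex-fresh {R = R} g b≤ ¬r =
      ¬⇒adj≡false g (subst₂ (λ x y → ¬ R x y) (sym toℕ-vertex) (sym (toℕ-fin n′ _ (≤-trans b≤ k+d≤n′))) ¬r)

    vertex-member : ∀ {M P} → Outside M P → ¬ P a → M (vertex a) ≡ true
    vertex-member {P = P} o ¬p = Outside-member o (vertex a) (subst (λ x → ¬ P x) (sym toℕ-vertex) ¬p)

    vertex-adj⇒ : ∀ {E R y} → Describes E R → adj E (vertex a) y ≡ true → R a (toℕ y)
    vertex-adj⇒ {R = R} {y} g e = subst (λ x → R x (toℕ y)) toℕ-vertex (adj⇒ g e)

    vertex-⇒adj : ∀ {E R y} → Describes E R → R a (toℕ y) → adj E (vertex a) y ≡ true
    vertex-⇒adj {R = R} {y} g r = ⇒adj g (subst (λ x → R x (toℕ y)) (sym toℕ-vertex) r)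

    ⇒adj-vertex : ∀ {E R y} → Describes E R → R (toℕ y) a → adj E y (vertex a) ≡ true
    ⇒adj-vertex {R = R} {y} g r = ⇒adj g (subst (R (toℕ y)) (sym toℕ-vertex) r)

    deg-vertex : ∀ {E R} → Describes E R → ∀ q → (∀ b → (R a b → q b ≡ true) × (q b ≡ true → R a b)) →
      deg E (vertex a) ≡ countBelow (suc n′) q
    deg-vertex {R = R} g q h =
      deg≡countBelow g (vertex a) q λ b _ → subst (λ x → (R x b → _) × (_ → R x b)) (sym toℕ-vertex) (h b)

    countBelow≤deg-vertex : ∀ {E R} → Describes E R → ∀ q → (∀ b → q b ≡ true → R a b) →
      countBelow (suc n′) q ≤ deg E (vertex a)
    countBelow≤deg-vertex {E} g q h = countBelow≤deg E (vertex a) q λ y qy → vertex-⇒adj g (h (toℕ y) qy)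

  Invariant : ℕ → ℕ → ℕ → Graph (suc n′) → State (suc n′) → Set
  Invariant i r j E M = Describes E (Sym (Edges i r j)) × Outside M (Evicted i r j)

  StepsTo : ∀ i r j (E : Graph (suc n′)) M (u v : Fin (suc n′)) (c : ℕ) → Set
  StepsTo i r j E M u v c = u ≢ v × adj E u v ≡ false ×
    Σ (State (suc n′)) (λ M′ → insertStep E M (u , v) ≡ ((u , v) ∷ E , M′ , c) × Invariant i r j ((u , v) ∷ E) M′)

  -- The new leaf has degree 1, so it is the endpoint evicted.
  module LeafStep (i : ℕ) (i<d : i < d) (E : Graph (suc n′)) (M : State (suc n′))
                  (g : Describes E (Sym (Edges i 0 0))) (o : Outside M (Evicted i 0 0)) where
    u v : Fin (suc n′)
    u = vertex k
    v = vertex (k + suc i)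
    E′ : Graph (suc n′)
    E′ = (u , v) ∷ E

    leaf≤ : k + suc i ≤ k + d
    leaf≤ = +-monoʳ-≤ k i<d

    k<leaf : k < k + suc i
    k<leaf = m<m+n k (s≤s z≤n)

    k+i<leaf : k + i < k + suc i
    k+i<leaf = +-monoʳ-< k ≤-refl

    not-edge : ¬ Sym (Edges i 0 0) k (k + suc i)
    not-edge (inj₁ (inj₁ (_ , _ , q))) = <⇒≱ k+i<leaf q
    not-edge (inj₁ (inj₂ (inj₁ (() , _))))
    not-edge (inj₁ (inj₂ (inj₂ (_ , p , q)))) = <⇒≱ p q
    not-edge (inj₂ (inj₁ (e , _ , _))) = <⇒≢ k<leaf (sym e)
    not-edge (inj₂ (inj₂ (inj₁ (() , _))))
    not-edge (inj₂ (inj₂ (inj₂ (_ , p , q)))) = <⇒≱ p q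

    hub-kept : ¬ Evicted i 0 0 k
    hub-kept (inj₁ (p , _)) = <-irrefl refl p
    hub-kept (inj₂ (inj₁ ()))
    hub-kept (inj₂ (inj₂ (p , q))) = <⇒≱ p q

    leaf-kept : ¬ Evicted i 0 0 (k + suc i)
    leaf-kept (inj₁ (_ , q)) = <⇒≱ k+i<leaf q
    leaf-kept (inj₂ (inj₁ ()))
    leaf-kept (inj₂ (inj₂ (p , q))) = <⇒≱ p q

    g′ : Describes E′ (Sym (Edges (suc i) 0 0))
    g′ = Describes-∷ u v (toℕ-vertex k≤k+d) (toℕ-vertex leaf≤) (Sym-∷ k (k + suc i) (Edges-leaf i)) g

    leaf-neighbour : ∀ b → Sym (Edges (suc i) 0 0) (k + suc i) b → b ≡ k
    leaf-neighbour b (inj₁ (inj₁ (e , _ , _))) = ⊥-elim (<⇒≢ k<leaf (sym e))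
    leaf-neighbour b (inj₁ (inj₂ (inj₁ (() , _))))
    leaf-neighbour b (inj₁ (inj₂ (inj₂ (_ , p , q)))) = ⊥-elim (<⇒≱ p q)
    leaf-neighbour b (inj₂ (inj₁ (e , _ , _))) = e
    leaf-neighbour b (inj₂ (inj₂ (inj₁ (() , _))))
    leaf-neighbour b (inj₂ (inj₂ (inj₂ (_ , p , q)))) = ⊥-elim (<⇒≱ p q)

    deg-leaf : deg E′ v ≡ 1
    deg-leaf = trans (deg-vertex leaf≤ g′ (between k (suc k)) nbr)
                     (countBelow-singleton k (s≤s (≤-trans k≤k+d k+d≤n′)))
      where
      nbr : ∀ b → (Sym (Edges (suc i) 0 0) (k + suc i) b → between k (suc k) b ≡ true) ×
                  (between k (suc k) b ≡ true → Sym (Edges (suc i) 0 0) (k + suc i) b)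
      nbr b = (λ s → let b≡k = leaf-neighbour b s in between⁺ (≤-reflexive (sym b≡k)) (s≤s (≤-reflexive b≡k))) ,
              (λ e → let (k≤b , b<1+k) = between⁻ k (suc k) b e in
                     inj₂ (inj₁ (≤-antisym (≤-pred b<1+k) k≤b , k<leaf , ≤-refl)))

    hub-stays : ∀ y → adj E′ v y ≡ true →
      (not (set M v false y) ∧ (mcount E′ (set M v false) y ≡ᵇ 0)) ≡ false
    hub-stays y e = member-not-addable E′ (set M v false) y (trans (set-≢ M v false y v≢y) My)
      where
      y≡k : toℕ y ≡ k
      y≡k = leaf-neighbour (toℕ y) (vertex-adj⇒ leaf≤ g′ e)
      v≢y : toℕ v ≢ toℕ y
      v≢y e′ = <⇒≢ k<leaf (sym (trans (sym (toℕ-vertex leaf≤)) (trans e′ y≡k)))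
      My : M y ≡ true
      My = Outside-member o y (subst (λ a → ¬ Evicted i 0 0 a) (sym y≡k) hub-kept)

    result : StepsTo (suc i) 0 0 E M u v 2
    result = vertex-≢ k≤k+d leaf≤ (<⇒≢ k<leaf) , vertex-fresh k≤k+d g leaf≤ not-edge , set M v false ,
             trans (insertStep-evicts-only E M u v (vertex-member k≤k+d o hub-kept) (vertex-member leaf≤ o leaf-kept)
                      (subst (_≤ deg E′ u) (sym deg-leaf) (deg-∷-pos E u v)) hub-stays)
                   (cong (λ t → (E′ , set M v false , suc (t + 0))) deg-leaf) ,
             g′ , Outside-remove v (toℕ-vertex leaf≤) o (Evicted-leaf i)

  -- Afterwards j+1 has degree r+1 ≤ deg r, so j+1 is evicted; its other neighbours 0, …, r−1
  -- stay dominated by the hub.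
  module StarStep (r j : ℕ) (r≤j : r ≤ j) (1+j<k : suc j < k) (E : Graph (suc n′)) (M : State (suc n′))
                  (g : Describes E (Sym (Edges d r j))) (o : Outside M (Evicted d r j)) where
    u v : Fin (suc n′)
    u = vertex r
    v = vertex (suc j)
    E′ : Graph (suc n′)
    E′ = (u , v) ∷ E
    Q′ : ℕ → ℕ → Set
    Q′ = Sym (Edges d r (suc j))

    r<k : r < k
    r<k = <-trans (s≤s r≤j) 1+j<k

    r≤ : r ≤ k + d
    r≤ = ≤-trans (<⇒≤ r<k) k≤k+d

    1+j≤ : suc j ≤ k + d
    1+j≤ = ≤-trans (<⇒≤ 1+j<k) k≤k+d

    not-edge : ¬ Sym (Edges d r j) r (suc j)
    not-edge (inj₁ (inj₁ (e , _ , _))) = <⇒≢ r<k e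
    not-edge (inj₁ (inj₂ (inj₁ (p , _)))) = <-irrefl refl p
    not-edge (inj₁ (inj₂ (inj₂ (_ , _ , q)))) = <-irrefl refl q
    not-edge (inj₂ (inj₁ (e , _ , _))) = <⇒≢ 1+j<k e
    not-edge (inj₂ (inj₂ (inj₁ (p , _)))) = <⇒≱ p (≤-trans r≤j (n≤1+n j))
    not-edge (inj₂ (inj₂ (inj₂ (e , _ , _)))) = <⇒≢ (s≤s r≤j) (sym e)

    r-kept : ¬ Evicted d r j r
    r-kept (inj₁ (p , _)) = <⇒≱ p (<⇒≤ r<k)
    r-kept (inj₂ (inj₁ p)) = <-irrefl refl p
    r-kept (inj₂ (inj₂ (p , _))) = <-irrefl refl p

    1+j-kept : ¬ Evicted d r j (suc j)
    1+j-kept (inj₁ (p , _)) = <⇒≱ p (<⇒≤ 1+j<k)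
    1+j-kept (inj₂ (inj₁ p)) = <⇒≱ p (≤-trans r≤j (n≤1+n j))
    1+j-kept (inj₂ (inj₂ (_ , q))) = <-irrefl refl q

    hub-kept : ¬ Evicted d r j k
    hub-kept (inj₁ (p , _)) = <-irrefl refl p
    hub-kept (inj₂ (inj₁ p)) = <⇒≱ p (<⇒≤ r<k)
    hub-kept (inj₂ (inj₂ (_ , q))) = <⇒≱ (<-trans (n<1+n j) 1+j<k) q

    g′ : Describes E′ Q′
    g′ = Describes-∷ u v (toℕ-vertex r≤) (toℕ-vertex 1+j≤) (Sym-∷ r (suc j) (Edges-star r j r≤j)) g

    v-neighbour : ∀ b → Q′ (suc j) b → b < suc r
    v-neighbour b (inj₁ (inj₁ (e , _ , _))) = ⊥-elim (<⇒≢ 1+j<k e)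
    v-neighbour b (inj₁ (inj₂ (inj₁ (p , _)))) = ⊥-elim (<⇒≱ p (≤-trans r≤j (n≤1+n j)))
    v-neighbour b (inj₁ (inj₂ (inj₂ (e , _ , _)))) = ⊥-elim (<⇒≢ (s≤s r≤j) (sym e))
    v-neighbour b (inj₂ (inj₁ (_ , p , _))) = ⊥-elim (<⇒≱ p (<⇒≤ 1+j<k))
    v-neighbour b (inj₂ (inj₂ (inj₁ (p , _)))) = m≤n⇒m≤1+n p
    v-neighbour b (inj₂ (inj₂ (inj₂ (e , _ , _)))) = s≤s (≤-reflexive e)

    neighbour-v : ∀ b → b < suc r → Q′ (suc j) b
    neighbour-v b b<1+r with m<1+n⇒m<n∨m≡n b<1+r
    ... | inj₁ b<r = inj₂ (inj₂ (inj₁ (b<r , <-trans b<r (s≤s r≤j) , <⇒≤ 1+j<k)))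
    ... | inj₂ b≡r = inj₂ (inj₂ (inj₂ (b≡r , s≤s r≤j , ≤-refl)))

    deg-v : deg E′ v ≡ suc r
    deg-v = trans (deg-vertex 1+j≤ g′ (_<ᵇ suc r) λ b → <⇒<ᵇ≡true ∘ v-neighbour b , neighbour-v b ∘ <ᵇ≡true⇒< b (suc r))
                  (countBelow-<ᵇ-≤ (s≤s (≤-trans r≤ k+d≤n′)))

    1+r≤deg-u : suc r ≤ deg E′ u
    1+r≤deg-u = ≤-trans (≤-reflexive (sym count)) (countBelow≤deg-vertex r≤ g′ q neighbour-u)
      where
      q : ℕ → Bool
      q b = (b <ᵇ r) ∨ between (suc j) (suc (suc j)) b
      count : countBelow (suc n′) q ≡ suc r
      count = begin
          countBelow (suc n′) q
        ≡⟨ countBelow-∨ (suc n′) (_<ᵇ r) _ (λ b b<r b≡1+j → <⇒≱ (<ᵇ≡true⇒< b r b<r)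
             (≤-trans r≤j (≤-trans (n≤1+n j) (proj₁ (between⁻ (suc j) (suc (suc j)) b b≡1+j))))) ⟩
          countBelow (suc n′) (_<ᵇ r) + countBelow (suc n′) (between (suc j) (suc (suc j)))
        ≡⟨ cong₂ _+_ (countBelow-<ᵇ-≤ (≤-trans r≤ (≤-trans k+d≤n′ (n≤1+n n′))))
                     (countBelow-singleton (suc j) (s≤s (≤-trans 1+j≤ k+d≤n′))) ⟩
          r + 1
        ≡⟨ +-comm r 1 ⟩
          suc r ∎
        where open ≡-Reasoning
      neighbour-u : ∀ b → q b ≡ true → Q′ r b
      neighbour-u b e with ∨≡true⁻ _ _ e
      ... | inj₁ b<r = let b<r = <ᵇ≡true⇒< b r b<r in inj₂ (inj₂ (inj₁ (b<r , b<r , <⇒≤ r<k)))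
      ... | inj₂ b≡1+j = let (1+j≤b , b<2+j) = between⁻ _ _ b b≡1+j in
                         inj₁ (inj₂ (inj₂ (refl , <-≤-trans (s≤s r≤j) 1+j≤b , ≤-pred b<2+j)))

    others-blocked : ∀ y → adj E′ v y ≡ true →
      (not (set M v false y) ∧ (mcount E′ (set M v false) y ≡ᵇ 0)) ≡ false
    others-blocked y e with m<1+n⇒m<n∨m≡n (v-neighbour (toℕ y) (vertex-adj⇒ 1+j≤ g′ e))
    ... | inj₂ y≡r = member-not-addable E′ (set M v false) y (trans (set-≢ M v false y v≢y) My)
      where
      v≢y : toℕ v ≢ toℕ y
      v≢y e′ = <⇒≢ (s≤s r≤j) (trans (sym y≡r) (trans (sym e′) (toℕ-vertex 1+j≤)))
      My : M y ≡ true
      My = Outside-member o y (subst (λ a → ¬ Evicted d r j a) (sym y≡r) r-kept)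
    ... | inj₁ y<r = dominated-not-addable E′ (set M v false) y (vertex k) y~hub hub-in
      where
      y~hub : adj E′ y (vertex k) ≡ true
      y~hub = ⇒adj-vertex k≤k+d g′ (inj₁ (inj₂ (inj₁ (y<r , <-trans y<r r<k , ≤-refl))))
      hub-in : set M v false (vertex k) ≡ true
      hub-in = trans (set-≢ M v false (vertex k) (λ e′ → <⇒≢ 1+j<k (trans (sym (toℕ-vertex 1+j≤)) (trans e′ (toℕ-vertex k≤k+d)))))
                     (vertex-member k≤k+d o hub-kept)

    result : StepsTo d r (suc j) E M u v (suc (suc r))
    result = vertex-≢ r≤ 1+j≤ (<⇒≢ (s≤s r≤j)) , vertex-fresh r≤ g 1+j≤ not-edge , set M v false ,
             trans (insertStep-evicts-only E M u v (vertex-member r≤ o r-kept) (vertex-member 1+j≤ o 1+j-kept)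
                      (subst (_≤ deg E′ u) (sym deg-v) 1+r≤deg-u) others-blocked)
                   (cong (λ t → (E′ , set M v false , suc t)) (trans (+-identityʳ _) deg-v)) ,
             g′ , Outside-remove v (toℕ-vertex 1+j≤) o (Evicted-star r j r≤j)

  -- r has degree k ≤ d ≤ deg(hub), so r is evicted; its star r+1, …, k−1 is then free and readmitted,
  -- each vertex costing its degree r+1.
  module HubStep (r j : ℕ) (r≤j : r ≤ j) (1+j≡k : suc j ≡ k) (E : Graph (suc n′)) (M : State (suc n′))
                 (g : Describes E (Sym (Edges d r j))) (o : Outside M (Evicted d r j)) where
    u v : Fin (suc n′)
    u = vertex k
    v = vertex r
    E′ : Graph (suc n′)
    E′ = (u , v) ∷ E
    Q′ : ℕ → ℕ → Set
    Q′ = Sym (Edges d (suc r) (suc r))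

    j<k : j < k
    j<k = subst (j <_) 1+j≡k ≤-refl

    r<k : r < k
    r<k = ≤-<-trans r≤j j<k

    r≤ : r ≤ k + d
    r≤ = ≤-trans (<⇒≤ r<k) k≤k+d

    not-edge : ¬ Sym (Edges d r j) k r
    not-edge (inj₁ (inj₁ (_ , p , _))) = <⇒≱ p (<⇒≤ r<k)
    not-edge (inj₁ (inj₂ (inj₁ (p , _)))) = <⇒≱ p (<⇒≤ r<k)
    not-edge (inj₁ (inj₂ (inj₂ (e , _ , _)))) = <⇒≢ r<k (sym e)
    not-edge (inj₂ (inj₁ (e , _ , _))) = <⇒≢ r<k e
    not-edge (inj₂ (inj₂ (inj₁ (p , _)))) = <-irrefl refl p
    not-edge (inj₂ (inj₂ (inj₂ (_ , _ , q)))) = <⇒≱ j<k q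

    r-kept : ¬ Evicted d r j r
    r-kept (inj₁ (p , _)) = <⇒≱ p (<⇒≤ r<k)
    r-kept (inj₂ (inj₁ p)) = <-irrefl refl p
    r-kept (inj₂ (inj₂ (p , _))) = <-irrefl refl p

    hub-kept : ¬ Evicted d r j k
    hub-kept (inj₁ (p , _)) = <-irrefl refl p
    hub-kept (inj₂ (inj₁ p)) = <⇒≱ p (<⇒≤ r<k)
    hub-kept (inj₂ (inj₂ (_ , q))) = <⇒≱ j<k q

    g′ : Describes E′ Q′
    g′ = Describes-∷ u v (toℕ-vertex k≤k+d) (toℕ-vertex r≤)
           (λ a b → let (to , from) = Sym-∷ r k (Edges-hub r j r≤j 1+j≡k) a b in
                    map₁ SameEdge-swap ∘ to , from ∘ map₁ SameEdge-swap) g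

    r-neighbour : ∀ b → Q′ r b → b < r ⊎ (r < b × b ≤ k)
    r-neighbour b (inj₁ (inj₁ (e , _ , _))) = ⊥-elim (<⇒≢ r<k e)
    r-neighbour b (inj₁ (inj₂ (inj₁ (_ , p , q)))) = inj₂ (p , q)
    r-neighbour b (inj₁ (inj₂ (inj₂ (e , _ , _)))) = ⊥-elim (<-irrefl e (n<1+n r))
    r-neighbour b (inj₂ (inj₁ (_ , p , _))) = ⊥-elim (<⇒≱ p (<⇒≤ r<k))
    r-neighbour b (inj₂ (inj₂ (inj₁ (_ , p , _)))) = inj₁ p
    r-neighbour b (inj₂ (inj₂ (inj₂ (_ , p , _)))) = ⊥-elim (<⇒≱ p (n≤1+n r))

    neighbour-r : ∀ b → b < r ⊎ (r < b × b ≤ k) → Q′ r b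
    neighbour-r b (inj₁ b<r) = inj₂ (inj₂ (inj₁ (m≤n⇒m≤1+n b<r , b<r , <⇒≤ r<k)))
    neighbour-r b (inj₂ (r<b , b≤k)) = inj₁ (inj₂ (inj₁ (≤-refl , r<b , b≤k)))

    deg-v : deg E′ v ≡ k
    deg-v = trans (deg-vertex r≤ g′ q λ b → to b ∘ r-neighbour b , neighbour-r b ∘ from b) count
      where
      q : ℕ → Bool
      q b = (b <ᵇ r) ∨ between (suc r) (suc k) b
      to : ∀ b → b < r ⊎ (r < b × b ≤ k) → q b ≡ true
      to b (inj₁ b<r) = ∨≡trueˡ _ _ (<⇒<ᵇ≡true b<r)
      to b (inj₂ (r<b , b≤k)) = ∨≡trueʳ (b <ᵇ r) _ (between⁺ r<b (s≤s b≤k))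
      from : ∀ b → q b ≡ true → b < r ⊎ (r < b × b ≤ k)
      from b e with ∨≡true⁻ _ _ e
      ... | inj₁ b<r = inj₁ (<ᵇ≡true⇒< b r b<r)
      ... | inj₂ inside = let (r<b , b<1+k) = between⁻ (suc r) (suc k) b inside in inj₂ (r<b , ≤-pred b<1+k)
      count : countBelow (suc n′) q ≡ k
      count = begin
          countBelow (suc n′) q
        ≡⟨ countBelow-∨ (suc n′) (_<ᵇ r) _ (λ b b<r inside → <⇒≱ (<ᵇ≡true⇒< b r b<r)
             (≤-trans (n≤1+n r) (proj₁ (between⁻ (suc r) (suc k) b inside)))) ⟩
          countBelow (suc n′) (_<ᵇ r) + countBelow (suc n′) (between (suc r) (suc k))
        ≡⟨ cong₂ _+_ (countBelow-<ᵇ-≤ (≤-trans r≤ (≤-trans k+d≤n′ (n≤1+n n′))))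
                     (countBelow-between (suc n′) (suc r) (suc k) (s≤s (<⇒≤ r<k)) (s≤s (≤-trans k≤k+d k+d≤n′))) ⟩
          r + (k ∸ r)
        ≡⟨ m+[n∸m]≡n (<⇒≤ r<k) ⟩
          k ∎
        where open ≡-Reasoning

    k≤deg-u : k ≤ deg E′ u
    k≤deg-u = ≤-trans k≤d (≤-trans (≤-reflexive (sym count)) (countBelow≤deg-vertex k≤k+d g′ leaves leaf-neighbour))
      where
      leaves : ℕ → Bool
      leaves = between (suc k) (suc (k + d))
      count : countBelow (suc n′) leaves ≡ d
      count = trans (countBelow-between (suc n′) (suc k) (suc (k + d)) (s≤s k≤k+d) (s≤s k+d≤n′)) (m+n∸m≡n k d)
      leaf-neighbour : ∀ b → leaves b ≡ true → Q′ k b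
      leaf-neighbour b e = let (k<b , b<1+k+d) = between⁻ _ _ b e in inj₁ (inj₁ (refl , k<b , ≤-pred b<1+k+d))

    star : Fin (suc n′) → Bool
    star x = between (suc r) k (toℕ x)

    star⁻ : ∀ y → star y ≡ true → r < toℕ y × toℕ y < k
    star⁻ y = between⁻ (suc r) k (toℕ y)

    star-neighbour : ∀ y b → r < y → y < k → Q′ y b → b < suc r
    star-neighbour y b r<y y<k (inj₁ (inj₁ (e , _ , _))) = ⊥-elim (<⇒≢ y<k e)
    star-neighbour y b r<y y<k (inj₁ (inj₂ (inj₁ (p , _)))) = ⊥-elim (<⇒≱ p r<y)
    star-neighbour y b r<y y<k (inj₁ (inj₂ (inj₂ (_ , p , q)))) = ⊥-elim (<⇒≱ p q)
    star-neighbour y b r<y y<k (inj₂ (inj₁ (_ , p , _))) = ⊥-elim (<⇒≱ p (<⇒≤ y<k))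
    star-neighbour y b r<y y<k (inj₂ (inj₂ (inj₁ (p , _)))) = p
    star-neighbour y b r<y y<k (inj₂ (inj₂ (inj₂ (_ , p , q)))) = ⊥-elim (<⇒≱ p q)

    deg-star : ∀ y → star y ≡ true → deg E′ y ≡ suc r
    deg-star y e = trans (deg≡countBelow g′ y (_<ᵇ suc r) nbr) (countBelow-<ᵇ-≤ (s≤s (≤-trans r≤ k+d≤n′)))
      where
      r<y : r < toℕ y
      r<y = proj₁ (star⁻ y e)
      y<k : toℕ y < k
      y<k = proj₂ (star⁻ y e)
      nbr : ∀ b → b < (suc n′) → (Q′ (toℕ y) b → (b <ᵇ suc r) ≡ true) × ((b <ᵇ suc r) ≡ true → Q′ (toℕ y) b)
      nbr b _ = <⇒<ᵇ≡true ∘ star-neighbour (toℕ y) b r<y y<k ,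
                λ e′ → let b<1+r = <ᵇ≡true⇒< b (suc r) e′ in
                       inj₂ (inj₂ (inj₁ (b<1+r , <-≤-trans b<1+r r<y , <⇒≤ y<k)))

    M₁ : State (suc n′)
    M₁ = set M v false
    L : List (Fin (suc n′))
    L = neighbours E′ v
    open AddFree E′ star

    v≢ : ∀ (y : Fin (suc n′)) → toℕ y ≢ r → toℕ v ≢ toℕ y
    v≢ y y≢r e = y≢r (trans (sym e) (toℕ-vertex r≤))

    star-out : ∀ {y} → y ∈ L → star y ≡ true → M₁ y ≡ false
    star-out {y} _ e = let (r<y , y<k) = star⁻ y e in
      trans (set-≢ M v false y (v≢ y (λ y≡r → <-irrefl (sym y≡r) r<y)))
            (⇒out o (inj₂ (inj₂ (r<y , ≤-pred (subst (toℕ y <_) (sym 1+j≡k) y<k)))))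

    star-free : TargetsFree M₁
    star-free y x e y~x = x-out (m<1+n⇒m<n∨m≡n x<1+r) , ≢true⇒≡false (λ e′ → <⇒≱ x<1+r (proj₁ (star⁻ x e′)))
      where
      x<1+r : toℕ x < suc r
      x<1+r = star-neighbour (toℕ y) (toℕ x) (proj₁ (star⁻ y e)) (proj₂ (star⁻ y e)) (adj⇒ g′ y~x)
      x-out : toℕ x < r ⊎ toℕ x ≡ r → M₁ x ≡ false
      x-out (inj₁ x<r) = trans (set-≢ M v false x (v≢ x (λ x≡r → <-irrefl x≡r x<r))) (⇒out o (inj₂ (inj₁ x<r)))
      x-out (inj₂ x≡r) rewrite toℕ-injective {i = x} {j = v} (trans x≡r (sym (toℕ-vertex r≤))) = set-≡ M v false

    hub-in : M₁ u ≡ true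
    hub-in = trans (set-≢ M v false u (λ e → <⇒≢ r<k (trans (sym (toℕ-vertex r≤)) (trans e (toℕ-vertex k≤k+d)))))
                   (vertex-member k≤k+d o hub-kept)

    hub-not-star : star u ≡ false
    hub-not-star = ≢true⇒≡false (λ e → <-irrefl (toℕ-vertex k≤k+d) (proj₂ (star⁻ u e)))

    others-blocked : ∀ {y} → y ∈ L → star y ≡ false → Blocked M₁ y
    others-blocked {y} y∈ ¬star with r-neighbour (toℕ y) (vertex-adj⇒ r≤ g′ (neighbours⇒adj {E = E′} y∈))
    ... | inj₁ y<r = inj₂ (u , ⇒adj-vertex k≤k+d g′ (inj₁ (inj₂ (inj₁ (m≤n⇒m≤1+n y<r , <-trans y<r r<k , ≤-refl)))) ,
                           hub-in , hub-not-star)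
    ... | inj₂ (r<y , y≤k) with m≤n⇒m<n∨m≡n y≤k
    ...   | inj₁ y<k = ⊥-elim (false≢true (trans (sym ¬star) (between⁺ r<y y<k)))
    ...   | inj₂ y≡k rewrite toℕ-injective {i = y} {j = u} (trans y≡k (sym (toℕ-vertex k≤k+d))) = inj₁ hub-in

    star-listed : ∀ x → star x ≡ true → x ∉ L → M₁ x ≡ true
    star-listed x e x∉ = ⊥-elim (x∉ (∈-neighbours {E = E′} (vertex-⇒adj r≤ g′ (neighbour-r (toℕ x)
                           (inj₂ (proj₁ (star⁻ x e) , <⇒≤ (proj₂ (star⁻ x e))))))))

    readmitted : AddsExactly M₁ L
    readmitted = addFree-exact L M₁ (neighbours-unique E′ v) star-out star-free others-blocked star-listed

    star-size : length (filterᵇ star L) ≡ k ∸ suc r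
    star-size = trans (cong length (filterᵇ-filterᵇ (adj E′ v) star (allFin (suc n′))))
                  (trans (length-filterᵇ-allFin (suc n′) (λ x → adj E′ v x ∧ star x) (between (suc r) k) pointwise)
                         (countBelow-between (suc n′) (suc r) k r<k (≤-trans k≤k+d (≤-trans k+d≤n′ (n≤1+n n′)))))
      where
      pointwise : ∀ x → adj E′ v x ∧ star x ≡ between (suc r) k (toℕ x)
      pointwise x with star x in e
      ... | false = ∧-zeroʳ (adj E′ v x)
      ... | true rewrite vertex-⇒adj r≤ {y = x} g′ (neighbour-r (toℕ x) (inj₂ (proj₁ (star⁻ x e) , <⇒≤ (proj₂ (star⁻ x e)))))
        = refl

    readmission-cost : proj₂ (addFree E′ M₁ L) ≡ (k ∸ suc r) * suc r
    readmission-cost = trans (proj₂ readmitted)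
      (trans (sum-map-const (deg E′) (suc r) (filterᵇ star L) (λ x∈ → deg-star _ (∈-filterᵇ⁻ star L x∈)))
             (cong (_* suc r) star-size))

    result : StepsTo d (suc r) (suc r) E M u v (suc (k + (k ∸ suc r) * suc r))
    result = vertex-≢ k≤k+d r≤ (<⇒≢ r<k ∘ sym) , vertex-fresh k≤k+d g r≤ not-edge , proj₁ (addFree E′ M₁ L) ,
             trans (insertStep-evicts E M u v (vertex-member k≤k+d o hub-kept) (vertex-member r≤ o r-kept)
                      (subst (_≤ deg E′ u) (sym deg-v) k≤deg-u))
                   (cong₂ (λ a b → (E′ , proj₁ (addFree E′ M₁ L) , suc (a + b))) deg-v readmission-cost) ,
             g′ , Outside-∨ (between (suc r) k)
                    (Outside-remove v (toℕ-vertex r≤) o (λ _ → id , id)) (proj₁ readmitted) (Evicted-hub r j r≤j 1+j≡k)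

  leafStep : ∀ i → i < d → ∀ E M → Invariant i 0 0 E M → StepsTo (suc i) 0 0 E M (vertex k) (vertex (k + suc i)) 2
  leafStep i i<d E M (g , o) = LeafStep.result i i<d E M g o

  starStep : ∀ r j → r ≤ j → suc j < k → ∀ E M → Invariant d r j E M →
    StepsTo d r (suc j) E M (vertex r) (vertex (suc j)) (suc (suc r))
  starStep r j r≤j 1+j<k E M (g , o) = StarStep.result r j r≤j 1+j<k E M g o

  hubStep : ∀ r j → r ≤ j → suc j ≡ k → ∀ E M → Invariant d r j E M →
    StepsTo d (suc r) (suc r) E M (vertex k) (vertex r) (suc (k + (k ∸ suc r) * suc r))
  hubStep r j r≤j 1+j≡k E M (g , o) = HubStep.result r j r≤j 1+j≡k E M g o

  edge : ℕ → ℕ → Edge (suc n′)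
  edge a b = (vertex a , vertex b)

  leafEdges : ℕ → ℕ → List (Edge (suc n′))
  leafEdges i zero = []
  leafEdges i (suc c) = edge k (k + suc i) ∷ leafEdges (suc i) c

  starEdges : ℕ → ℕ → ℕ → List (Edge (suc n′))
  starEdges r j zero = []
  starEdges r j (suc c) = edge r (suc j) ∷ starEdges r (suc j) c

  rounds : ℕ → ℕ → List (Edge (suc n′))
  rounds r zero = []
  rounds r (suc c) = starEdges r r (k ∸ suc r) ++ (edge k r ∷ rounds (suc r) c)

  roundCost : ℕ → ℕ
  roundCost r = (k ∸ suc r) * suc (suc r) + suc (k + (k ∸ suc r) * suc r)

  roundsCost : ℕ → ℕ → ℕ
  roundsCost r zero = 0
  roundsCost r (suc c) = roundCost r + roundsCost (suc r) c

  leaves-phase : ∀ c i → i + c ≡ d → ∀ rest K → (∀ E M → Invariant d 0 0 E M → Realises E M rest K) →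
    ∀ E M → Invariant i 0 0 E M → Realises E M (leafEdges i c ++ rest) (c * 2 + K)
  leaves-phase zero i i≡d rest K next E M inv =
    next E M (subst (λ t → Invariant t 0 0 E M) (trans (sym (+-identityʳ i)) i≡d) inv)
  leaves-phase (suc c) i i+1+c≡d rest K next E M inv
    with leafStep i (subst (i <_) i+1+c≡d (m<m+n i (s≤s z≤n))) E M inv
  ... | (u≢v , fresh , M′ , step , inv′) =
    subst (Realises E M _) (sym (+-assoc 2 (c * 2) K))
      (Realises-∷ E M _ _ _ u≢v fresh step
        (leaves-phase c (suc i) (trans (sym (+-suc i c)) i+1+c≡d) rest K next _ M′ inv′))

  star-phase : ∀ c r j → r ≤ j → j + c < k → ∀ rest K → (∀ E M → Invariant d r (j + c) E M → Realises E M rest K) →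
    ∀ E M → Invariant d r j E M → Realises E M (starEdges r j c ++ rest) (c * suc (suc r) + K)
  star-phase zero r j r≤j _ rest K next E M inv = next E M (subst (λ t → Invariant d r t E M) (sym (+-identityʳ j)) inv)
  star-phase (suc c) r j r≤j j+1+c<k rest K next E M inv
    with starStep r j r≤j (≤-<-trans (subst (suc j ≤_) (sym (+-suc j c)) (s≤s (m≤m+n j c))) j+1+c<k) E M inv
  ... | (u≢v , fresh , M′ , step , inv′) =
    subst (Realises E M _) (sym (+-assoc (suc (suc r)) (c * suc (suc r)) K))
      (Realises-∷ E M _ _ _ u≢v fresh step
        (star-phase c r (suc j) (m≤n⇒m≤1+n r≤j) (subst (_< k) (+-suc j c) j+1+c<k) rest K
          (λ E₁ M₁ inv₁ → next E₁ M₁ (subst (λ t → Invariant d r t E₁ M₁) (sym (+-suc j c)) inv₁)) _ M′ inv′))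

  rounds-phase : ∀ c r → r + c ≡ k → ∀ rest K → (∀ E M → Invariant d k k E M → Realises E M rest K) →
    ∀ E M → Invariant d r r E M → Realises E M (rounds r c ++ rest) (roundsCost r c + K)
  rounds-phase zero r r≡k rest K next E M inv = next E M (subst (λ t → Invariant d t t E M) (trans (sym (+-identityʳ r)) r≡k) inv)
  rounds-phase (suc c) r r+1+c≡k rest K next E M inv =
    subst₂ (Realises E M) (sym (++-assoc (starEdges r r c′) (edge k r ∷ rounds (suc r) c) rest))
                          (reassoc (c′ * suc (suc r)) (suc (k + c′ * suc r)) (roundsCost (suc r) c) K)
      (star-phase c′ r r ≤-refl (subst (r + c′ <_) 1+r+c′≡k ≤-refl) _ _ close-round E M inv)
    where
    r<k : r < k
    r<k = subst (r <_) r+1+c≡k (m<m+n r (s≤s z≤n))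
    c′ : ℕ
    c′ = k ∸ suc r
    1+r+c′≡k : suc (r + c′) ≡ k
    1+r+c′≡k = m+[n∸m]≡n r<k
    reassoc : ∀ a b c x → a + (b + (c + x)) ≡ ((a + b) + c) + x
    reassoc = solve-∀
    close-round : ∀ E₁ M₁ → Invariant d r (r + c′) E₁ M₁ →
      Realises E₁ M₁ (edge k r ∷ (rounds (suc r) c ++ rest)) (suc (k + c′ * suc r) + (roundsCost (suc r) c + K))
    close-round E₁ M₁ inv₁ with hubStep r (r + c′) (m≤m+n r c′) 1+r+c′≡k E₁ M₁ inv₁
    ... | (u≢v , fresh , M′ , step , inv′) =
      Realises-∷ E₁ M₁ _ _ _ u≢v fresh step
        (rounds-phase c (suc r) (trans (sym (+-suc r c)) r+1+c≡k) rest K next _ M′ inv′)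

  -- Every padding edge ends in an evicted leaf, so costs 1.
  paddingRow : ℕ → ℕ → List (Edge (suc n′))
  paddingRow b zero = []
  paddingRow b (suc x) = if x ≡ᵇ k then paddingRow b x else edge x b ∷ paddingRow b x

  padding : ℕ → List (Edge (suc n′))
  padding zero = []
  padding (suc c) = paddingRow (k + suc c) (k + suc c) ++ padding c

  -- Columns beyond b₀ are complete; column b₀ is filled from row x₀ upwards.
  PadEdges : ℕ → ℕ → ℕ → ℕ → Set
  PadEdges b₀ x₀ a b = a < b × (b₀ < b ⊎ (b ≡ b₀ × x₀ ≤ a))

  Padded : ℕ → ℕ → ℕ → ℕ → Set
  Padded b₀ x₀ a b = Sym (Edges d k k) a b ⊎ Sym (PadEdges b₀ x₀) a b

  Padded-suc : ∀ b x a c → Padded b (suc x) a c → Padded b x a c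
  Padded-suc b x a c (inj₁ q) = inj₁ q
  Padded-suc b x a c (inj₂ (inj₁ (p , inj₁ q))) = inj₂ (inj₁ (p , inj₁ q))
  Padded-suc b x a c (inj₂ (inj₁ (p , inj₂ (e , q)))) = inj₂ (inj₁ (p , inj₂ (e , ≤-trans (n≤1+n x) q)))
  Padded-suc b x a c (inj₂ (inj₂ (p , inj₁ q))) = inj₂ (inj₂ (p , inj₁ q))
  Padded-suc b x a c (inj₂ (inj₂ (p , inj₂ (e , q)))) = inj₂ (inj₂ (p , inj₂ (e , ≤-trans (n≤1+n x) q)))

  paddingRow-valid : ∀ x b → k < b → b ≤ k + d → x ≤ b → ∀ rest → (∀ E → Within E (Padded b 0) → ValidSeq E rest) →
    ∀ E → Within E (Padded b x) → ValidSeq E (paddingRow b x ++ rest)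
  paddingRow-valid zero b k<b b≤ x≤b rest next E w = next E w
  paddingRow-valid (suc x) b k<b b≤ x<b rest next E w with x ≡ᵇ k in x≟k
  ... | true = paddingRow-valid x b k<b b≤ (≤-trans (n≤1+n x) x<b) rest next E
                 (Within-weaken {E = E} (Padded-suc b x) w)
  ... | false = vertex-≢ x≤ b≤ (<⇒≢ x<b) , fresh ,
                paddingRow-valid x b k<b b≤ (≤-trans (n≤1+n x) x<b) rest next ((vertex x , vertex b) ∷ E) w′
    where
    x≤ : x ≤ k + d
    x≤ = ≤-trans (<⇒≤ x<b) b≤
    x≢k : x ≢ k
    x≢k x≡k = false≢true (trans (sym x≟k) (subst (λ t → (x ≡ᵇ t) ≡ true) x≡k (≡ᵇ-refl x)))
    new : ¬ Padded b (suc x) x b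
    new (inj₁ (inj₁ (inj₁ (e , _)))) = x≢k e
    new (inj₁ (inj₁ (inj₂ (inj₁ (_ , _ , q))))) = <⇒≱ k<b q
    new (inj₁ (inj₁ (inj₂ (inj₂ (e , _))))) = x≢k e
    new (inj₁ (inj₂ (inj₁ (e , _)))) = <⇒≢ k<b (sym e)
    new (inj₁ (inj₂ (inj₂ (inj₁ (p , _))))) = <⇒≱ p (<⇒≤ k<b)
    new (inj₁ (inj₂ (inj₂ (inj₂ (e , _))))) = <⇒≢ k<b (sym e)
    new (inj₂ (inj₁ (_ , inj₁ q))) = <-irrefl refl q
    new (inj₂ (inj₁ (_ , inj₂ (_ , q)))) = <-irrefl refl q
    new (inj₂ (inj₂ (p , _))) = <⇒≱ p (<⇒≤ x<b)
    fresh : adj E (vertex x) (vertex b) ≡ false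
    fresh = ≢true⇒≡false (λ e → new (subst₂ (Padded b (suc x)) (toℕ-vertex x≤) (toℕ-vertex b≤) (w _ _ e)))
    w′ : Within ((vertex x , vertex b) ∷ E) (Padded b x)
    w′ = Within-∷ {E = E} (vertex x) (vertex b) extend w
      where
      extend : ∀ a c → SameEdge (toℕ (vertex x)) (toℕ (vertex b)) a c ⊎ Padded b (suc x) a c → Padded b x a c
      extend a c (inj₁ (inj₁ (a≡x , c≡b))) rewrite toℕ-vertex x≤ | toℕ-vertex b≤ | a≡x | c≡b =
        inj₂ (inj₁ (x<b , inj₂ (refl , ≤-refl)))
      extend a c (inj₁ (inj₂ (a≡b , c≡x))) rewrite toℕ-vertex x≤ | toℕ-vertex b≤ | a≡b | c≡x =
        inj₂ (inj₂ (x<b , inj₂ (refl , ≤-refl)))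
      extend a c (inj₂ p) = Padded-suc b x a c p

  padding-valid : ∀ c → c ≤ d → ∀ E → Within E (Padded (k + c) (k + c)) → ValidSeq E (padding c)
  padding-valid zero _ E _ = tt
  padding-valid (suc c) 1+c≤d E w =
    paddingRow-valid b b k<b (+-monoʳ-≤ k 1+c≤d) ≤-refl (padding c)
      (λ E₁ w₁ → padding-valid c (≤-trans (n≤1+n c) 1+c≤d) E₁ (Within-weaken {E = E₁} column-done w₁)) E w
    where
    b : ℕ
    b = k + suc c
    k<b : k < b
    k<b = m<m+n k (s≤s z≤n)
    k+c<b : k + c < b
    k+c<b = +-monoʳ-< k ≤-refl
    column-done : ∀ a x → Padded b 0 a x → Padded (k + c) (k + c) a x
    column-done a x (inj₁ q) = inj₁ q
    column-done a x (inj₂ (inj₁ (p , inj₁ q))) = inj₂ (inj₁ (p , inj₁ (<-trans k+c<b q)))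
    column-done a x (inj₂ (inj₁ (p , inj₂ (e , _)))) = inj₂ (inj₁ (p , inj₁ (subst (k + c <_) (sym e) k+c<b)))
    column-done a x (inj₂ (inj₂ (p , inj₁ q))) = inj₂ (inj₂ (p , inj₁ (<-trans k+c<b q)))
    column-done a x (inj₂ (inj₂ (p , inj₂ (e , _)))) = inj₂ (inj₂ (p , inj₁ (subst (k + c <_) (sym e) k+c<b)))

  paddingRow-evicted : ∀ b x → k < b → b ≤ k + d → All (λ uv → Evicted d k k (toℕ (proj₂ uv))) (paddingRow b x)
  paddingRow-evicted b zero k<b b≤ = []
  paddingRow-evicted b (suc x) k<b b≤ with x ≡ᵇ k
  ... | true = paddingRow-evicted b x k<b b≤
  ... | false = subst (Evicted d k k) (sym (toℕ-vertex b≤)) (inj₁ (k<b , b≤)) ∷ paddingRow-evicted b x k<b b≤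

  padding-evicted : ∀ c → c ≤ d → All (λ uv → Evicted d k k (toℕ (proj₂ uv))) (padding c)
  padding-evicted zero _ = []
  padding-evicted (suc c) 1+c≤d = All.++⁺ (paddingRow-evicted (k + suc c) (k + suc c) (m<m+n k (s≤s z≤n)) (+-monoʳ-≤ k 1+c≤d))
                                           (padding-evicted c (≤-trans (n≤1+n c) 1+c≤d))

  length-paddingRow : ∀ b x → length (paddingRow b x) + boolToℕ (k <ᵇ x) ≡ x
  length-paddingRow b zero = refl
  length-paddingRow b (suc x) with x ≡ᵇ k in x≟k
  ... | true rewrite ≡ᵇ≡true⇒≡ x k x≟k | <⇒<ᵇ≡true (n<1+n k) = begin
      length (paddingRow b k) + 1                        ≡⟨ cong (_+ 1) (+-identityʳ _) ⟨
      length (paddingRow b k) + 0 + 1                    ≡⟨ cong (λ t → length (paddingRow b k) + boolToℕ t + 1) k≮k ⟨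
      length (paddingRow b k) + boolToℕ (k <ᵇ k) + 1     ≡⟨ cong (_+ 1) (length-paddingRow b k) ⟩
      k + 1                                              ≡⟨ +-comm k 1 ⟩
      suc k                                              ∎
    where
    open ≡-Reasoning
    k≮k : (k <ᵇ k) ≡ false
    k≮k = ≢true⇒≡false (λ e → <-irrefl refl (<ᵇ≡true⇒< k k e))
  ... | false = trans (cong (suc (length (paddingRow b x)) +_) (cong boolToℕ same)) (cong suc (length-paddingRow b x))
    where
    same : (k <ᵇ suc x) ≡ (k <ᵇ x)
    same = ≡-from-≡true (λ e → <⇒<ᵇ≡true (k<x (<ᵇ≡true⇒< k (suc x) e)))
                        (λ e → <⇒<ᵇ≡true (m<n⇒m<1+n (<ᵇ≡true⇒< k x e)))
      where
      k<x : k < suc x → k < x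
      k<x k<1+x with m≤n⇒m<n∨m≡n (≤-pred k<1+x)
      ... | inj₁ k<x = k<x
      ... | inj₂ k≡x = ⊥-elim (false≢true (trans (sym x≟k) (subst (λ t → (x ≡ᵇ t) ≡ true) (sym k≡x) (≡ᵇ-refl x))))

  length-padding : ∀ c → length (padding c) ≡ c * k + triangular c
  length-padding zero = refl
  length-padding (suc c) = begin
      length (paddingRow b b ++ padding c)
    ≡⟨ length-++ (paddingRow b b) ⟩
      length (paddingRow b b) + length (padding c)
    ≡⟨ cong₂ _+_ row (length-padding c) ⟩
      (k + c) + (c * k + triangular c)
    ≡⟨ ring k c (triangular c) ⟩
      (k + c * k) + (c + triangular c) ∎
    where
    open ≡-Reasoning
    b : ℕ
    b = k + suc c
    row : length (paddingRow b b) ≡ k + c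
    row = +-cancelʳ-≡ 1 _ _ (begin
        length (paddingRow b b) + 1
      ≡⟨ cong (λ t → length (paddingRow b b) + boolToℕ t) (<⇒<ᵇ≡true (m<m+n k (s≤s z≤n))) ⟨
        length (paddingRow b b) + boolToℕ (k <ᵇ b)
      ≡⟨ length-paddingRow b b ⟩
        k + suc c
      ≡⟨ trans (+-suc k c) (+-comm 1 (k + c)) ⟩
        k + c + 1 ∎)
    ring : ∀ k c t → (k + c) + (c * k + t) ≡ (k + c * k) + (c + t)
    ring = solve-∀

  length-leafEdges : ∀ i c → length (leafEdges i c) ≡ c
  length-leafEdges i zero = refl
  length-leafEdges i (suc c) = cong suc (length-leafEdges (suc i) c)

  length-starEdges : ∀ r j c → length (starEdges r j c) ≡ c
  length-starEdges r j zero = refl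
  length-starEdges r j (suc c) = cong suc (length-starEdges r (suc j) c)

  length-rounds : ∀ c r → r + c ≡ k → length (rounds r c) ≡ triangular c + c
  length-rounds zero r _ = refl
  length-rounds (suc c) r r+1+c≡k = begin
      length (starEdges r r (k ∸ suc r) ++ (edge k r ∷ rounds (suc r) c))
    ≡⟨ length-++ (starEdges r r (k ∸ suc r)) ⟩
      length (starEdges r r (k ∸ suc r)) + suc (length (rounds (suc r) c))
    ≡⟨ cong₂ (λ a b → a + suc b) (trans (length-starEdges r r (k ∸ suc r)) k∸1+r≡c)
                                  (length-rounds c (suc r) (trans (sym (+-suc r c)) r+1+c≡k)) ⟩
      c + suc (triangular c + c)
    ≡⟨ ring c (triangular c) ⟩
      (c + triangular c) + suc c ∎
    where
    open ≡-Reasoning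
    k∸1+r≡c : k ∸ suc r ≡ c
    k∸1+r≡c = subst (λ t → t ∸ suc r ≡ c) (trans (sym (+-suc r c)) r+1+c≡k) (m+n∸m≡n (suc r) c)
    ring : ∀ c t → c + suc (t + c) ≡ (c + t) + suc c
    ring = solve-∀

  Invariant-initial : Invariant 0 0 0 [] (λ _ → true)
  Invariant-initial = record { adj⇒ = λ () ; ⇒adj = ⊥-elim ∘ no-edge _ _ } ,
                      record { out⇒ = λ () ; ⇒out = ⊥-elim ∘ none-evicted _ }
    where
    no-edge₀ : ∀ a b → ¬ Edges 0 0 0 a b
    no-edge₀ a b (inj₁ (_ , p , q)) = <⇒≱ p (subst (b ≤_) (+-identityʳ k) q)
    no-edge₀ a b (inj₂ (inj₁ (() , _)))
    no-edge₀ a b (inj₂ (inj₂ (_ , p , q))) = <⇒≱ p q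
    no-edge : ∀ a b → ¬ Sym (Edges 0 0 0) a b
    no-edge a b (inj₁ s) = no-edge₀ a b s
    no-edge a b (inj₂ s) = no-edge₀ b a s
    none-evicted : ∀ a → ¬ Evicted 0 0 0 a
    none-evicted a (inj₁ (p , q)) = <⇒≱ p (subst (a ≤_) (+-identityʳ k) q)
    none-evicted a (inj₂ (inj₁ ()))
    none-evicted a (inj₂ (inj₂ (p , q))) = <⇒≱ p q

  insertions : ℕ → List (Edge (suc n′))
  insertions t = leafEdges 0 d ++ (rounds 0 k ++ take t (padding d))

  length-take-padding : ∀ t → t ≤ length (padding d) → length (take t (padding d)) ≡ t
  length-take-padding t t≤ = trans (length-take t (padding d)) (m≤n⇒m⊓n≡m t≤)

  length-insertions : ∀ t → t ≤ length (padding d) → length (insertions t) ≡ d + ((triangular k + k) + t)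
  length-insertions t t≤ = trans (length-++ (leafEdges 0 d))
    (cong₂ _+_ (length-leafEdges 0 d)
               (trans (length-++ (rounds 0 k)) (cong₂ _+_ (length-rounds k 0 refl) (length-take-padding t t≤))))

  insertions-realise : ∀ t → t ≤ length (padding d) →
    Realises [] (λ _ → true) (insertions t) (d * 2 + (roundsCost 0 k + t))
  insertions-realise t t≤ = leaves-phase d 0 refl _ _ (rounds-phase k 0 refl _ _ pad) [] _ Invariant-initial
    where
    pad : ∀ E M → Invariant d k k E M → Realises E M (take t (padding d)) t
    pad E M (g , o) =
      ValidSeq-take t E (padding d) (padding-valid d ≤-refl E λ x y e → inj₁ (adj⇒ g e)) ,
      trans (runCost-cheap E M (take t (padding d))
               (All.take⁺ t (All.map (⇒out o) (padding-evicted d ≤-refl)))) (length-take-padding t t≤)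

  roundCost-bound : ℕ
  roundCost-bound = k * suc k + suc (k + k * k)

  roundCost≤ : ∀ r → r < k → roundCost r ≤ roundCost-bound
  roundCost≤ r r<k = +-mono-≤ (*-mono-≤ (m∸n≤m k (suc r)) (s≤s r<k))
                              (s≤s (+-monoʳ-≤ k (*-mono-≤ (m∸n≤m k (suc r)) r<k)))

  roundsCost≤ : ∀ c r → r + c ≡ k → roundsCost r c ≤ c * roundCost-bound
  roundsCost≤ zero r _ = z≤n
  roundsCost≤ (suc c) r r+1+c≡k =
    +-mono-≤ (roundCost≤ r (subst (r <_) r+1+c≡k (m<m+n r (s≤s z≤n))))
             (roundsCost≤ c (suc r) (trans (sym (+-suc r c)) r+1+c≡k))

  -- Round r readmits k−r−1 vertices of degree r+1.
  roundsCost≥ : ∀ c r → r + c ≡ k → suc r * triangular c + tetrahedral c ≤ roundsCost r c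
  roundsCost≥ zero r _ = ≤-reflexive (cong (_+ 0) (*-zeroʳ r))
  roundsCost≥ (suc c) r r+1+c≡k = begin
      suc r * triangular (suc c) + tetrahedral (suc c)
    ≡⟨ ring r c (triangular c) (tetrahedral c) ⟩
      c * suc r + (suc (suc r) * triangular c + tetrahedral c)
    ≤⟨ +-mono-≤ readmissions (roundsCost≥ c (suc r) (trans (sym (+-suc r c)) r+1+c≡k)) ⟩
      roundCost r + roundsCost (suc r) c ∎
    where
    open ≤-Reasoning
    k∸1+r≡c : k ∸ suc r ≡ c
    k∸1+r≡c = subst (λ t → t ∸ suc r ≡ c) (trans (sym (+-suc r c)) r+1+c≡k) (m+n∸m≡n (suc r) c)
    readmissions : c * suc r ≤ roundCost r
    readmissions = ≤-trans (*-mono-≤ (≤-reflexive (sym k∸1+r≡c)) (n≤1+n (suc r))) (m≤m+n _ _)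
    ring : ∀ r c t u → suc r * (c + t) + (t + u) ≡ c * suc r + (suc (suc r) * t + u)
    ring = solve-∀

1+k²≤2m : ∀ k m → 4 * (k * k) ≤ m → 1 ≤ m → suc k * suc k ≤ 2 * m
1+k²≤2m k m 4k²≤m 1≤m = begin
    suc k * suc k                            ≡⟨ ring₁ k ⟩
    k * k + k + k + 1                        ≤⟨ +-monoˡ-≤ 1 (+-mono-≤ (+-monoʳ-≤ (k * k) (n≤n*n k)) (≤-trans (n≤n*n k) (m≤m+n _ _))) ⟩
    k * k + k * k + (k * k + k * k) + 1      ≡⟨ ring₂ k ⟩
    4 * (k * k) + 1                          ≤⟨ +-mono-≤ 4k²≤m 1≤m ⟩
    m + m                                    ≡⟨ ring₃ m ⟩
    2 * m                                    ∎
  where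
  open ≤-Reasoning
  ring₁ : ∀ k → suc k * suc k ≡ k * k + k + k + 1
  ring₁ = solve-∀
  ring₂ : ∀ k → k * k + k * k + (k * k + k * k) + 1 ≡ 4 * (k * k) + 1
  ring₂ = solve-∀
  ring₃ : ∀ m → m + m ≡ 2 * m
  ring₃ = solve-∀

square-bound : ∀ m T k → 4 * (k * k) ≤ m → 1 ≤ m → T ≤ 2 * m * suc k → T ^ 2 ≤ 8 * m ^ 3
square-bound m T k 4k²≤m 1≤m T≤ = begin
    T ^ 2                                    ≡⟨ ^2≡ T ⟩
    T * T                                    ≤⟨ *-mono-≤ T≤ T≤ ⟩
    (2 * m * suc k) * (2 * m * suc k)        ≡⟨ ring₁ m k ⟩
    4 * (m * m) * (suc k * suc k)            ≤⟨ *-monoʳ-≤ (4 * (m * m)) (1+k²≤2m k m 4k²≤m 1≤m) ⟩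
    4 * (m * m) * (2 * m)                    ≡⟨ ring₂ m ⟩
    8 * (m * (m * m))                        ≡⟨ cong (8 *_) (^3≡ m) ⟨
    8 * m ^ 3                                ∎
  where
  open ≤-Reasoning
  ring₁ : ∀ m k → (2 * m * suc k) * (2 * m * suc k) ≡ 4 * (m * m) * (suc k * suc k)
  ring₁ = solve-∀
  ring₂ : ∀ m → 4 * (m * m) * (2 * m) ≡ 8 * (m * (m * m))
  ring₂ = solve-∀

-- 589824 = 64 · 96²: for k ≥ 3, m³ ≤ 64 (k+1)⁶ ≤ 64 (96 tet k)²; smaller k are covered by m ≤ 36.
cube-bound : ∀ m T k → m < 4 * (suc k * suc k) → m ≤ T → tetrahedral k ≤ T → m ^ 3 ≤ 589824 * T ^ 2
cube-bound m T k m< m≤T tet≤T = subst₂ _≤_ (sym (^3≡ m)) (cong (589824 *_) (sym (^2≡ T))) (by-size k m< tet≤T)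
  where
  small : m ≤ 36 → m * (m * m) ≤ 589824 * (T * T)
  small m≤36 = begin
      m * (m * m)          ≤⟨ *-monoˡ-≤ (m * m) m≤36 ⟩
      36 * (m * m)         ≤⟨ *-monoʳ-≤ 36 (*-mono-≤ m≤T m≤T) ⟩
      36 * (T * T)         ≤⟨ *-monoˡ-≤ (T * T) (m≤m+n 36 589788) ⟩
      589824 * (T * T)     ∎
    where open ≤-Reasoning
  by-size : ∀ k → m < 4 * (suc k * suc k) → tetrahedral k ≤ T → m * (m * m) ≤ 589824 * (T * T)
  by-size 0 m< _ = small (≤-trans (<⇒≤ m<) (m≤m+n 4 32))
  by-size 1 m< _ = small (≤-trans (<⇒≤ m<) (m≤m+n 16 20))
  by-size 2 m< _ = small (<⇒≤ m<)
  by-size (suc (suc (suc j))) m< tet≤T = begin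
      m * (m * m)
    ≤⟨ *-mono-≤ m≤ (*-mono-≤ m≤ m≤) ⟩
      (4 * (Y * Y)) * ((4 * (Y * Y)) * (4 * (Y * Y)))
    ≡⟨ ring₁ Y ⟩
      64 * ((Y * (Y * Y)) * (Y * (Y * Y)))
    ≤⟨ *-monoʳ-≤ 64 (*-mono-≤ Y³≤ Y³≤) ⟩
      64 * ((96 * T) * (96 * T))
    ≡⟨ ring₂ T ⟩
      589824 * (T * T) ∎
    where
    open ≤-Reasoning
    Y : ℕ
    Y = j + 4
    m≤ : m ≤ 4 * (Y * Y)
    m≤ = subst (λ y → m ≤ 4 * (y * y)) (+-comm 4 j) (<⇒≤ m<)
    Y³≤ : Y * (Y * Y) ≤ 96 * T
    Y³≤ = ≤-trans (cube≤96*tetrahedral j)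
                  (*-monoʳ-≤ 96 (subst (λ x → tetrahedral x ≤ T) (+-comm 3 j) tet≤T))
    ring₁ : ∀ Y → (4 * (Y * Y)) * ((4 * (Y * Y)) * (4 * (Y * Y))) ≡ 64 * ((Y * (Y * Y)) * (Y * (Y * Y)))
    ring₁ = solve-∀
    ring₂ : ∀ T → 64 * ((96 * T) * (96 * T)) ≡ 589824 * (T * T)
    ring₂ T = begin-equality
      64 * ((96 * T) * (96 * T))    ≡⟨ cong (64 *_) (*-assoc 96 T (96 * T)) ⟩
      64 * (96 * (T * (96 * T)))    ≡⟨ cong (λ x → 64 * (96 * x)) (x*[c*y]≡c*[x*y] T 96 T) ⟩
      64 * (96 * (96 * (T * T)))    ≡⟨ *-assoc 64 96 (96 * (T * T)) ⟨
      64 * 96 * (96 * (T * T))      ≡⟨ *-assoc (64 * 96) 96 (T * T) ⟨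
      589824 * (T * T)              ∎
      where
      x*[c*y]≡c*[x*y] : ∀ x c y → x * (c * y) ≡ c * (x * y)
      x*[c*y]≡c*[x*y] x c y = trans (sym (*-assoc x c y)) (trans (cong (_* y) (*-comm x c)) (*-assoc c x y))

-- Choosing k ≈ √m / 2, d ≥ k leaves, and t padding edges so that d + (k² + k)/2 + t = m.
module Parameters (n′ m : ℕ) (1+n′≤m : suc n′ ≤ m) (m≤ : m ≤ suc n′ C 2) where

  k : ℕ
  k = proj₁ (halfSqrt m)

  4k²≤m : 4 * (k * k) ≤ m
  4k²≤m = proj₁ (proj₂ (halfSqrt m))

  m<4[1+k]² : m < 4 * (suc k * suc k)
  m<4[1+k]² = proj₂ (proj₂ (halfSqrt m))

  1≤m : 1 ≤ m
  1≤m = ≤-trans (s≤s z≤n) 1+n′≤m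

  m≤triangular : m ≤ triangular (suc n′)
  m≤triangular = subst (m ≤_) (nC2≡triangular (suc n′)) m≤

  k+k≤n′ : k + k ≤ n′
  k+k≤n′ = ≤-pred (≰⇒> λ 1+n′≤2k → <⇒≱ (triangular<square (suc n′) (s≤s z≤n)) (begin
      suc n′ * suc n′       ≤⟨ *-mono-≤ 1+n′≤2k 1+n′≤2k ⟩
      (k + k) * (k + k)     ≡⟨ ring k ⟩
      4 * (k * k)           ≤⟨ 4k²≤m ⟩
      m                     ≤⟨ m≤triangular ⟩
      triangular (suc n′)   ∎))
    where
    open ≤-Reasoning
    ring : ∀ k → (k + k) * (k + k) ≡ 4 * (k * k)
    ring = solve-∀

  k≤n′ : k ≤ n′
  k≤n′ = ≤-trans (m≤m+n k k) k+k≤n′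

  roundEdges : ℕ
  roundEdges = triangular k + k

  roundEdges+k≤m : roundEdges + k ≤ m
  roundEdges+k≤m = begin
      triangular k + k + k      ≤⟨ +-mono-≤ (+-mono-≤ (triangular≤square k) (n≤n*n k)) (n≤n*n k) ⟩
      k * k + k * k + k * k     ≡⟨ ring k ⟩
      3 * (k * k)               ≤⟨ *-monoˡ-≤ (k * k) (m≤m+n 3 1) ⟩
      4 * (k * k)               ≤⟨ 4k²≤m ⟩
      m                         ∎
    where
    open ≤-Reasoning
    ring : ∀ k → k * k + k * k + k * k ≡ 3 * (k * k)
    ring = solve-∀

  roundEdges≤m : roundEdges ≤ m
  roundEdges≤m = ≤-trans (m≤m+n roundEdges k) roundEdges+k≤m

  d : ℕ
  d = (n′ ∸ k) ⊓ (m ∸ roundEdges)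

  k+d≤n′ : k + d ≤ n′
  k+d≤n′ = ≤-trans (+-monoʳ-≤ k (m⊓n≤m (n′ ∸ k) _)) (≤-reflexive (m+[n∸m]≡n k≤n′))

  k≤d : k ≤ d
  k≤d = ⊓-glb (subst (_≤ n′ ∸ k) (m+n∸m≡n k k) (∸-monoˡ-≤ k k+k≤n′))
              (subst (_≤ m ∸ roundEdges) (m+n∸m≡n roundEdges k) (∸-monoˡ-≤ roundEdges roundEdges+k≤m))

  open Construction n′ k d k+d≤n′ k≤d

  roundEdges+d≤m : roundEdges + d ≤ m
  roundEdges+d≤m = ≤-trans (+-monoʳ-≤ roundEdges (m⊓n≤n (n′ ∸ k) _)) (≤-reflexive (m+[n∸m]≡n roundEdges≤m))

  t : ℕ
  t = m ∸ (roundEdges + d)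

  -- Either d = m − roundEdges and no padding is needed, or d = n′ − k and the padding
  -- completes the graph to all C(n′+1, 2) ≥ m edges.
  t≤padding : t ≤ length (padding d)
  t≤padding = subst (t ≤_) (sym (length-padding d)) (t≤ (≤-total (n′ ∸ k) (m ∸ roundEdges)))
    where
    t≤ : (n′ ∸ k) ≤ (m ∸ roundEdges) ⊎ (m ∸ roundEdges) ≤ (n′ ∸ k) → t ≤ d * k + triangular d
    t≤ (inj₂ saturated) = subst (_≤ d * k + triangular d) (sym t≡0) z≤n
      where
      t≡0 : t ≡ 0
      t≡0 = trans (cong (λ x → m ∸ (roundEdges + x)) (m≥n⇒m⊓n≡n saturated))
                  (trans (cong (m ∸_) (m+[n∸m]≡n roundEdges≤m)) (n∸n≡0 m))
    t≤ (inj₁ all-vertices) = ≤-trans (∸-monoˡ-≤ (roundEdges + d) m≤triangular)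
                                     (≤-reflexive (trans (cong (_∸ (roundEdges + d)) all-edges) (m+n∸m≡n (roundEdges + d) _)))
      where
      k+d≡n′ : k + d ≡ n′
      k+d≡n′ = trans (cong (k +_) (m≤n⇒m⊓n≡m all-vertices)) (m+[n∸m]≡n k≤n′)
      ring : ∀ k d a b → (k + d) + (a + b + k * d) ≡ (a + k + d) + (d * k + b)
      ring = solve-∀
      all-edges : triangular (suc n′) ≡ (roundEdges + d) + (d * k + triangular d)
      all-edges = trans (cong (λ x → x + triangular x) (sym k+d≡n′))
                        (trans (cong ((k + d) +_) (triangular-+ k d)) (ring k d (triangular k) (triangular d)))

  σ : List (Edge (suc n′))
  σ = insertions t

  length-σ : length σ ≡ m
  length-σ = trans (length-insertions t t≤padding) (trans (ring d roundEdges t) (m+[n∸m]≡n roundEdges+d≤m))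
    where
    ring : ∀ d c t → d + (c + t) ≡ (c + d) + t
    ring = solve-∀

  valid-σ : ValidSeq [] σ
  valid-σ = proj₁ (insertions-realise t t≤padding)

  totalTime≡ : totalTime σ ≡ d * 2 + (roundsCost 0 k + t)
  totalTime≡ = proj₂ (insertions-realise t t≤padding)

  totalTime≤ : totalTime σ ≤ 2 * m * suc k
  totalTime≤ = begin
      totalTime σ                              ≡⟨ totalTime≡ ⟩
      d * 2 + (roundsCost 0 k + t)             ≤⟨ m≤m+n _ t ⟩
      d * 2 + (roundsCost 0 k + t) + t         ≡⟨ ring₁ d (roundsCost 0 k) t ⟩
      2 * (d + t) + roundsCost 0 k             ≤⟨ +-mono-≤ (*-monoʳ-≤ 2 d+t≤m) (≤-trans (roundsCost≤ k 0 refl) (*-monoʳ-≤ k bound≤2m)) ⟩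
      2 * m + k * (2 * m)                      ≡⟨ ring₂ m k ⟩
      2 * m * suc k                            ∎
    where
    open ≤-Reasoning
    d+t≤m : d + t ≤ m
    d+t≤m = ≤-trans (m≤n+m (d + t) roundEdges) (≤-reflexive (trans (sym (+-assoc roundEdges d t)) (m+[n∸m]≡n roundEdges+d≤m)))
    bound≤2m : roundCost-bound ≤ 2 * m
    bound≤2m = begin
        k * suc k + suc (k + k * k)                  ≡⟨ ring₃ k ⟩
        k * k + k * k + k + k + 1                    ≤⟨ +-monoˡ-≤ 1 (+-mono-≤ (+-monoʳ-≤ (k * k + k * k) (n≤n*n k)) (n≤n*n k)) ⟩
        k * k + k * k + k * k + k * k + 1            ≡⟨ ring₄ k ⟩
        4 * (k * k) + 1                              ≤⟨ +-mono-≤ 4k²≤m 1≤m ⟩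
        m + m                                        ≡⟨ m+m≡2*m m ⟩
        2 * m                                        ∎
      where
      ring₃ : ∀ k → k * suc k + suc (k + k * k) ≡ k * k + k * k + k + k + 1
      ring₃ = solve-∀
      ring₄ : ∀ k → k * k + k * k + k * k + k * k + 1 ≡ 4 * (k * k) + 1
      ring₄ = solve-∀
      m+m≡2*m : ∀ m → m + m ≡ 2 * m
      m+m≡2*m = solve-∀
    ring₁ : ∀ d r t → d * 2 + (r + t) + t ≡ 2 * (d + t) + r
    ring₁ = solve-∀
    ring₂ : ∀ m k → 2 * m + k * (2 * m) ≡ 2 * m * suc k
    ring₂ = solve-∀

  m≤totalTime : m ≤ totalTime σ
  m≤totalTime = subst (_≤ totalTime σ) length-σ (length≤runCost [] (λ _ → true) σ)

  tetrahedral≤totalTime : tetrahedral k ≤ totalTime σ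
  tetrahedral≤totalTime = begin
      tetrahedral k                              ≤⟨ m≤n+m _ (1 * triangular k) ⟩
      1 * triangular k + tetrahedral k           ≤⟨ roundsCost≥ k 0 refl ⟩
      roundsCost 0 k                             ≤⟨ m≤m+n _ t ⟩
      roundsCost 0 k + t                         ≤⟨ m≤n+m _ (d * 2) ⟩
      d * 2 + (roundsCost 0 k + t)               ≡⟨ totalTime≡ ⟨
      totalTime σ                                ∎
    where open ≤-Reasoning

  hard-sequence : ∃[ σ ] (length σ ≡ m × ValidSeq {suc n′} [] σ
                          × m ^ 3 ≤ 589824 * (totalTime σ ^ 2) × totalTime σ ^ 2 ≤ 8 * m ^ 3)
  hard-sequence = σ , length-σ , valid-σ ,
    cube-bound m (totalTime σ) k m<4[1+k]² m≤totalTime tetrahedral≤totalTime ,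
    square-bound m (totalTime σ) k 4k²≤m 1≤m totalTime≤

hard-insertion-sequence : (n m : ℕ) → n ≤ m → m ≤ n C 2 →
  ∃[ σ ] (length σ ≡ m × ValidSeq {n} [] σ × m ^ 3 ≤ 589824 * (totalTime σ ^ 2) × totalTime σ ^ 2 ≤ 8 * m ^ 3)
hard-insertion-sequence zero zero _ _ = [] , refl , tt , z≤n , z≤n
hard-insertion-sequence zero (suc m) _ ()
hard-insertion-sequence (suc n′) m 1+n′≤m m≤ = Parameters.hard-sequence n′ m 1+n′≤m m≤

theorem8 : ∃[ c₁ ] ∃[ c₂ ] ((n m : ℕ) → n ≤ m → m ≤ n C 2 →
               ∃[ σ ] (length σ ≡ m × ValidSeq {n} [] σ
                       × m ^ 3 ≤ c₁ * (totalTime σ ^ 2)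
                       × totalTime σ ^ 2 ≤ c₂ * m ^ 3))
theorem8 = 589824 , 8 , hard-insertion-sequence
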